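{- For $i\in\{1,2\}$, let $G_i^\infty$ be the infinite simple graph with vertex set $\{x_j,y_j : j\in\mathbb{N},\ j\ge 3-i\}$ and edge set $\{\{x_j,x_{j+1}\},\{x_j,y_j\} : j\ge 3-i\}$, and let $S_i(\mathbf{x},\mathbf{y},z)=S_{G_i^\infty}(\mathbf{v},z)$ be its multivariable subgraph enumerating series. Let $S_i^w(q,z)$ be obtained from $S_i(\mathbf{x},\mathbf{y},z)$ by substituting $x_j\mapsto q^j$ and $y_j\mapsto q^j$ for all $j$. Then $$1+\sum_{\lambda\in\mathcal{N}_i}\delta(\lambda)q^{|\lambda|}=S_i^w(q,-1).$$
   Context: For a simple graph $G$ with countable vertex set $\{v_j : j\in I\}$, its multivariable subgraph enumerating series is $S_G(\mathbf{v},z)=\sum_H\big(\prod_{v_j\in V(H)}v_j\big)z^{|E(H)|}$, where $H$ ranges over finite subgraphs of $G$ without isolated vertices (every vertex of $H$ is an endpoint of an edge of $H$), including the empty subgraph, which contributes $1$. A partition of a positive integer $n$ is a non-increasing sequence of positive integers $\lambda=(\lambda_1,\dots,\lambda_r)$ with $|\lambda|:=\sum\lambda_k=n$. $\mathcal{N}_i$ is the set of partitions $\lambda$ of positive integers such that: (1) for every part $\lambda_j$ there is an index $l\neq j$ with $|\lambda_l-\lambda_j|\le1$; (2) every part value occurs at most twice; (3) every part is $\ge 3-i$. For such $\lambda$, $G_\lambda$ is the simple graph with one vertex per part (a part value $h$ of multiplicity $1$ gives $x_h$; of multiplicity $2$ gives $x_h,y_h$) and edges $\{x_{h+1},x_h\}$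 and $\{x_l,y_l\}$ whenever both endpoints are vertices. The signature is $\delta(\lambda)=\sum_H(-1)^{|E(H)|}$ over subgraphs $H$ of $G_\lambda$ with $V(H)=V(G_\lambda)$ and no isolated vertices. -}

module Defs where

open import Data.Nat using (ℕ; zero; suc; _+_; _*_; _∸_; _≤_; _<_; _≡ᵇ_; ∣_-_∣)
open import Data.Bool using (Bool; true; false; if_then_else_; _∨_; _∧_; not)
open import Data.Integer as ℤ using (ℤ; 0ℤ; 1ℤ; -1ℤ)
open import Data.List using (List; []; _∷_; _++_; map; length; lookup; concatMap; foldr; filterᵇ; [_])
open import Data.Nat.ListAction using (sum)
open import Data.Bool.ListAction using (any; all)
open import Data.List.Relation.Unary.All using (All)
open import Data.List.Relation.Unary.Linked using (Linked)
open import Data.Fin using (Fin)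
open import Data.Product using (Σ; ∃; _×_; _,_)
open import Relation.Binary.PropositionalEquality using (_≡_; _≢_)
open import Relation.Nullary using (¬_)

sumℤ : List ℤ → ℤ
sumℤ = foldr ℤ._+_ 0ℤ

sgn : ℕ → ℤ
sgn k = -1ℤ ℤ.^ k

subsets : {A : Set} → List A → List (List A)
subsets [] = [] ∷ []
subsets (a ∷ as) = subsets as ++ map (a ∷_) (subsets as)

occ : ℕ → List ℕ → ℕ
occ h [] = 0
occ h (k ∷ ks) = if h ≡ᵇ k then suc (occ h ks) else occ h ks

dedup : List ℕ → List ℕ
dedup [] = []
dedup (h ∷ t) = h ∷ filterᵇ (λ k → not (h ≡ᵇ k)) (dedup t)

record InN (i : ℕ) (λs : List ℕ) : Set where
  field
    nonIncreasing : Linked (λ a b → b ≤ a) λs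
    positive      : All (λ h → 1 ≤ h) λs
    nonEmpty      : 0 < sum λs
    cond1 : (j : Fin (length λs)) →
            Σ (Fin (length λs)) (λ l → (l ≢ j) × (∣ lookup λs l - lookup λs j ∣ ≤ 1))
    cond2 : (h : ℕ) → occ h λs ≤ 2
    cond3 : All (λ h → 3 ∸ i ≤ h) λs

data Vtx : Set where
  vx : ℕ → Vtx
  vy : ℕ → Vtx

data GEdge : Set where
  exx : ℕ → GEdge   -- edge {x_h , x_(h+1)}
  exy : ℕ → GEdge

incident : Vtx → GEdge → Bool
incident (vx h) (exx k) = (h ≡ᵇ k) ∨ (h ≡ᵇ suc k)
incident (vx h) (exy k) = h ≡ᵇ k
incident (vy h) (exx k) = false
incident (vy h) (exy k) = h ≡ᵇ k

isPart : ℕ → List ℕ → Bool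
isPart h λs = any (h ≡ᵇ_) λs

isDouble : ℕ → List ℕ → Bool
isDouble h λs = 2 Data.Nat.≤ᵇ occ h λs
  where import Data.Nat

vertsG : List ℕ → List Vtx
vertsG λs = concatMap (λ h → vx h ∷ (if isDouble h λs then [ vy h ] else [])) (dedup λs)

edgesG : List ℕ → List GEdge
edgesG λs = concatMap
  (λ h → (if isPart (suc h) λs then [ exx h ] else [])
         ++ (if isDouble h λs then [ exy h ] else []))
  (dedup λs)

spanning : List ℕ → List GEdge → Bool
spanning λs E = all (λ v → any (incident v) E) (vertsG λs)

δ : List ℕ → ℤ
δ λs = sumℤ (map (λ E → if spanning λs E then sgn (length E) else 0ℤ) (subsets (edgesG λs)))

-- Finite subgraphs of G_i^∞ (without isolated vertices) are determined
-- by their (finite) edge sets.  An edge set is encoded by a list of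
-- pairs (a , b); the k-th entry refers to level j = k + (3 - i):
--   a = true  iff  {x_j , x_(j+1)} ∈ E(H)
--   b = true  iff  {x_j , y_j}     ∈ E(H)
-- The encoding is canonical when there is no trailing (false , false).

SubG : Set
SubG = List (Bool × Bool)

Canonical : SubG → Set
Canonical H = ¬ (Σ SubG (λ H' → H ≡ H' ++ [ (false , false) ]))

nEdges : SubG → ℕ
nEdges [] = 0
nEdges ((a , b) ∷ H) = (if a then 1 else 0) + (if b then 1 else 0) + nEdges H

-- weight after x_j ↦ q^j, y_j ↦ q^j : sum of indices of vertices of H.
-- wt j p H : H starts at level j, p = edge {x_(j-1), x_j} present.
wt : ℕ → Bool → SubG → ℕ
wt j p [] = if p then j else 0
wt j p ((a , b) ∷ H) =
  (if p ∨ a ∨ b then j else 0) + (if b then j else 0) + wt (suc j) a H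

weight : ℕ → SubG → ℕ
weight i H = wt (3 ∸ i) false H

module Submission where

-- Fix the first level s = 3 ∸ i ≥ 1. A finite subgraph of G_i^∞ without isolated vertices is
-- determined by its edge set E, and its weight is the sum of the indices of its vertices, i.e.
-- |μ(E)| for the partition μ(E) listing those indices. Expanding δ(λ) as a signed sum over edge sets
-- of G_λ that cover all of its vertices turns the left-hand side into Σ_λ Σ_E (−1)^|E| [E spans G_λ].
-- A nonempty E spans G_λ for at most one λ ∈ N_i, namely λ = μ(E), since the multiplicity of a part h
-- of λ must be the number of vertices of E at level h; conversely μ(E) lies in N_i (every vertex of E
-- has a neighbour at distance at most one, and each level carries at most two vertices) and E spans
-- G_μ(E). Exchanging the two sums therefore leaves Σ_{E ≠ ∅, |μ(E)| = n} (−1)^|E|, and the empty edge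
-- set supplies the constant term. All edge sets involved use only levels below s + n, so both sides
-- are finite sums over the subsets of that universe of edges.

open import Defs
open import Data.Nat using (ℕ; _≤_; _≡ᵇ_)
open import Data.Bool using (if_then_else_)
open import Data.Integer using (ℤ; 0ℤ; 1ℤ; _+_)
open import Data.List using (List; map)
open import Data.Nat.ListAction using (sum)
open import Data.List.Membership.Propositional using (_∈_)
open import Data.List.Relation.Unary.Unique.Propositional using (Unique)
open import Data.Product using (Σ; _×_)
open import Function.Bundles using (_⇔_)
open import Relation.Binary.PropositionalEquality using (_≡_)

open import Algebra.Bundles using (CommutativeMonoid)
open import Data.Bool using (Bool; true; false; T; _∧_; _∨_; not)
open import Data.Bool.ListAction using (all; any)
open import Data.Bool.Properties
  using (T-≡; T-not-≡; T-∧; T-∨; ∨-comm; ∨-identityʳ; ∨-commutativeMonoid)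
open import Data.Empty using (⊥-elim)
open import Data.Fin using (Fin)
import Data.Fin as Fin
import Data.Fin.Properties as Fin
import Data.Integer.Properties as ℤ
open import Data.List
  using ([]; _∷_; _++_; [_]; length; lookup; filter; filterᵇ; concatMap; applyDownFrom; replicate)
import Data.List.Properties as List
open import Data.List.Membership.Propositional using (_∉_; find; lose)
import Data.List.Membership.DecPropositional as DecMembership
open import Data.List.Membership.Propositional.Properties
  using (∈-lookup; ∈-filter⁺; ∈-filter⁻; ∈-concatMap⁺; ∈-concatMap⁻; ∈-map⁺; ∈-map⁻; ∈-++⁺ˡ; ∈-++⁺ʳ; ∈-++⁻)
open import Data.List.Relation.Binary.Sublist.Propositional using (_⊆_; []; _∷_; _∷ʳ_)
import Data.List.Relation.Binary.Sublist.Propositional as Sublist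
import Data.List.Relation.Binary.Sublist.Propositional.Properties as Sublist
open import Data.List.Relation.Unary.All using (All; []; _∷_)
import Data.List.Relation.Unary.All as All
open import Data.List.Relation.Unary.All.Properties using (All¬⇒¬Any; all⁺; all⁻)
import Data.List.Relation.Unary.All.Properties as All
open import Data.List.Relation.Unary.AllPairs using (AllPairs; []; _∷_)
import Data.List.Relation.Unary.AllPairs.Properties as AllPairs
open import Data.List.Relation.Unary.Any using (here; there; index)
open import Data.List.Relation.Unary.Any.Properties
  using (lookup-index; any⁺; any⁻; applyDownFrom⁺; applyDownFrom⁻)
open import Data.List.Relation.Unary.Linked using (Linked; []; [-]; _∷_; linked?)
import Data.List.Relation.Unary.Linked as Linked
open import Data.List.Relation.Unary.Linked.Properties using (Linked⇒All)
import Data.List.Relation.Unary.Unique.Propositional.Properties as Unique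
open import Data.Nat as ℕ using (zero; suc; s≤s; z≤n; _≥_; _<_; _>_; ∣_-_∣; _∸_)
open import Data.Nat.ListAction.Properties using (sum-++)
open import Data.Nat.Properties
  using ( _≟_; _≤?_; _<?_; ≡ᵇ⇒≡; ≡⇒≡ᵇ; ≤ᵇ⇒≤; ≤⇒≤ᵇ; suc-injective; 1+n≢n
        ; ≤-refl; ≤-trans; ≤-antisym; ≤-pred; <-irrefl; <-trans; ≤-<-trans; <-≤-trans; <⇒≤; <⇒≢
        ; ≤∧≢⇒<; ≰⇒>; n<1⇒n≡0; n≤1+n; m≤n⇒m≤1+n; m≤m+n; m≤n+m
        ; +-comm; +-assoc; +-suc; +-identityʳ; +-mono-≤; +-monoˡ-≤; +-monoʳ-≤; +-monoʳ-<
        ; +-cancelˡ-≡; +-cancelˡ-<; m+[n∸m]≡n; m+n∸m≡n; m<n⇒0<n∸m; ∣n-n∣≡0; module ≤-Reasoning)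
open import Data.Product using (∃; _,_; proj₁; proj₂)
open import Data.Sum using (_⊎_; inj₁; inj₂)
open import Data.Unit using (tt)
open import Function using (_∘_; const; flip)
open import Function.Bundles using (mk⇔; Equivalence)
open import Function.Properties.Equivalence using () renaming (sym to ⇔-sym; trans to ⇔-trans)
open import Relation.Binary.Definitions using (DecidableEquality)
open import Relation.Binary.PropositionalEquality
  using (refl; sym; trans; cong; cong₂; subst; _≢_; module ≡-Reasoning)
open import Relation.Nullary using (¬_; Dec; does; yes; no; map′)
open import Relation.Nullary.Decidable using (T?; _×-dec_; ¬?; dec-true; dec-false; does-⇔)

open import Data.List.Membership.DecPropositional _≟_ using () renaming (_∈?_ to _∈ℕ?_)
open import Algebra.Properties.CommutativeSemigroup ℤ.+-commutativeSemigroup using (interchange)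
open import Algebra.Properties.CommutativeSemigroup (CommutativeMonoid.commutativeSemigroup ∨-commutativeMonoid)
  using () renaming (interchange to ∨-interchange)

sumℤ-++ : (xs ys : List ℤ) → sumℤ (xs ++ ys) ≡ sumℤ xs + sumℤ ys
sumℤ-++ []       ys = sym (ℤ.+-identityˡ _)
sumℤ-++ (x ∷ xs) ys = trans (cong (x +_) (sumℤ-++ xs ys)) (sym (ℤ.+-assoc x _ _))

module _ {A : Set} where

  sumℤ-cong : {f g : A → ℤ} (xs : List A) → (∀ {x} → x ∈ xs → f x ≡ g x) →
              sumℤ (map f xs) ≡ sumℤ (map g xs)
  sumℤ-cong []       _   = refl
  sumℤ-cong (x ∷ xs) f≗g = cong₂ _+_ (f≗g (here refl)) (sumℤ-cong xs (f≗g ∘ there))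

  sumℤ-zero : (f : A → ℤ) (xs : List A) → (∀ {x} → x ∈ xs → f x ≡ 0ℤ) → sumℤ (map f xs) ≡ 0ℤ
  sumℤ-zero f xs f≗0 = trans (sumℤ-cong {g = λ _ → 0ℤ} xs f≗0) (zeros xs)
    where
    zeros : (ys : List A) → sumℤ (map (λ _ → 0ℤ) ys) ≡ 0ℤ
    zeros []       = refl
    zeros (_ ∷ ys) = trans (ℤ.+-identityˡ _) (zeros ys)

  sumℤ-+ : (f g : A → ℤ) (xs : List A) →
           sumℤ (map (λ x → f x + g x) xs) ≡ sumℤ (map f xs) + sumℤ (map g xs)
  sumℤ-+ f g []       = refl
  sumℤ-+ f g (x ∷ xs) = trans (cong (f x + g x +_) (sumℤ-+ f g xs)) (interchange (f x) (g x) _ _)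

  sumℤ-filterᵇ : (f : A → ℤ) (p : A → Bool) (xs : List A) →
            sumℤ (map f (filterᵇ p xs)) ≡ sumℤ (map (λ x → if p x then f x else 0ℤ) xs)
  sumℤ-filterᵇ f p []       = refl
  sumℤ-filterᵇ f p (x ∷ xs) with p x
  ... | true  = cong (f x +_) (sumℤ-filterᵇ f p xs)
  ... | false = trans (sumℤ-filterᵇ f p xs) (sym (ℤ.+-identityˡ _))

  sumℤ-single : (f : A → ℤ) {a : A} {xs : List A} → Unique xs → a ∈ xs →
                (∀ {x} → x ∈ xs → x ≢ a → f x ≡ 0ℤ) → sumℤ (map f xs) ≡ f a
  sumℤ-single f {xs = x ∷ xs} (x∉xs ∷ _) (here refl) f≗0 =
    trans (cong (f x +_) (sumℤ-zero f xs (λ y∈xs → f≗0 (there y∈xs) (λ y≡x → All.lookup x∉xs y∈xs (sym y≡x)))))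
          (ℤ.+-identityʳ (f x))
  sumℤ-single f {xs = x ∷ xs} (x∉xs ∷ u) (there a∈xs) f≗0 =
    trans (cong₂ _+_ (f≗0 (here refl) (All.lookup x∉xs a∈xs)) (sumℤ-single f u a∈xs (f≗0 ∘ there)))
          (ℤ.+-identityˡ _)

sumℤ-swap : {A B : Set} (g : A → B → ℤ) (xs : List A) (ys : List B) →
  sumℤ (map (λ x → sumℤ (map (g x) ys)) xs) ≡ sumℤ (map (λ y → sumℤ (map (λ x → g x y) xs)) ys)
sumℤ-swap g []       ys = sym (sumℤ-zero _ ys (λ _ → refl))
sumℤ-swap g (x ∷ xs) ys =
  trans (cong (sumℤ (map (g x) ys) +_) (sumℤ-swap g xs ys)) (sym (sumℤ-+ (g x) _ ys))

unique-map⁺ : {A B : Set} {f : A → B} {xs : List A} → Unique xs →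
              (∀ {x y} → x ∈ xs → y ∈ xs → f x ≡ f y → x ≡ y) → Unique (map f xs)
unique-map⁺                       []             _     = []
unique-map⁺ {f = f} {xs = x ∷ xs} (x∉xs ∷ uniq) f-inj =
  All.map⁺ (All.tabulate (λ y∈xs fx≡fy → All.lookup x∉xs y∈xs (f-inj (here refl) (there y∈xs) fx≡fy)))
  ∷ unique-map⁺ uniq (λ x∈ y∈ → f-inj (there x∈) (there y∈))

module _ {A : Set} where

  subsets⁺ : {E U : List A} → E ⊆ U → E ∈ subsets U
  subsets⁺ []                     = here refl
  subsets⁺ (_ ∷ʳ E⊆U)             = ∈-++⁺ˡ (subsets⁺ E⊆U)
  subsets⁺ {U = u ∷ U} (refl ∷ E⊆U) = ∈-++⁺ʳ (subsets U) (∈-map⁺ (u ∷_) (subsets⁺ E⊆U))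

  subsets⁻ : (U : List A) {E : List A} → E ∈ subsets U → E ⊆ U
  subsets⁻ []      (here refl) = []
  subsets⁻ (u ∷ U) E∈ with ∈-++⁻ (subsets U) E∈
  ... | inj₁ E∈′ = u ∷ʳ subsets⁻ U E∈′
  ... | inj₂ uE∈ with ∈-map⁻ (u ∷_) uE∈
  ...   | _ , E∈′ , refl = refl ∷ subsets⁻ U E∈′

  ∉-subsets : {u : A} {U E : List A} → u ∉ U → E ∈ subsets U → u ∉ E
  ∉-subsets {U = U} u∉U E∈ u∈E = u∉U (Sublist.lookup (subsets⁻ U E∈) u∈E)

  ⊆-unique-ext : {U E₁ E₂ : List A} → Unique U → E₁ ⊆ U → E₂ ⊆ U →
    (∀ {e} → e ∈ E₁ → e ∈ E₂) → (∀ {e} → e ∈ E₂ → e ∈ E₁) → E₁ ≡ E₂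
  ⊆-unique-ext _              []            []            _     _     = refl
  ⊆-unique-ext (_ ∷ uniqueU)  (_ ∷ʳ E₁⊆U)   (_ ∷ʳ E₂⊆U)   E₁→E₂ E₂→E₁ =
    ⊆-unique-ext uniqueU E₁⊆U E₂⊆U E₁→E₂ E₂→E₁
  ⊆-unique-ext (u∉U ∷ _)      (_ ∷ʳ E₁⊆U)   (refl ∷ _)    _     E₂→E₁ =
    ⊥-elim (All¬⇒¬Any u∉U (Sublist.lookup E₁⊆U (E₂→E₁ (here refl))))
  ⊆-unique-ext (u∉U ∷ _)      (refl ∷ _)    (_ ∷ʳ E₂⊆U)   E₁→E₂ _     =
    ⊥-elim (All¬⇒¬Any u∉U (Sublist.lookup E₂⊆U (E₁→E₂ (here refl))))
  ⊆-unique-ext {u ∷ _} (u∉U ∷ uniqueU) (refl ∷ E₁⊆U) (refl ∷ E₂⊆U) E₁→E₂ E₂→E₁ =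
    cong (u ∷_) (⊆-unique-ext uniqueU E₁⊆U E₂⊆U (drop-head E₁⊆U E₁→E₂) (drop-head E₂⊆U E₂→E₁))
    where
    drop-head : ∀ {E E′} → E ⊆ _ → (∀ {e} → e ∈ u ∷ E → e ∈ u ∷ E′) → ∀ {e} → e ∈ E → e ∈ E′
    drop-head E⊆U E→E′ e∈E with E→E′ (there e∈E)
    ... | here refl = ⊥-elim (All¬⇒¬Any u∉U (Sublist.lookup E⊆U e∈E))
    ... | there e∈E′ = e∈E′

  subsets-unique : {U : List A} → Unique U → Unique (subsets U)
  subsets-unique []                        = [] ∷ []
  subsets-unique {u ∷ U} (u∉U ∷ uniqueU) =
    Unique.++⁺ (subsets-unique uniqueU) (Unique.map⁺ List.∷-injectiveʳ (subsets-unique uniqueU)) disjoint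
    where
    disjoint : ∀ {E} → ¬ (E ∈ subsets U × E ∈ map (u ∷_) (subsets U))
    disjoint (E∈ , uE∈) with ∈-map⁻ (u ∷_) uE∈
    ... | _ , _ , refl = ∉-subsets (All¬⇒¬Any u∉U) E∈ (here refl)

  subsets-head : (U : List A) → ∃ λ T → subsets U ≡ [] ∷ T
  subsets-head []      = _ , refl
  subsets-head (u ∷ U) with subsets-head U
  ... | T , eq rewrite eq = _ , refl

  sumℤ-subsets-∷ : (g : List A → ℤ) (u : A) (U : List A) →
    sumℤ (map g (subsets (u ∷ U))) ≡ sumℤ (map g (subsets U)) + sumℤ (map (g ∘ (u ∷_)) (subsets U))
  sumℤ-subsets-∷ g u U = begin
    sumℤ (map g (subsets U ++ map (u ∷_) (subsets U)))
      ≡⟨ cong sumℤ (List.map-++ g (subsets U) _) ⟩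
    sumℤ (map g (subsets U) ++ map g (map (u ∷_) (subsets U)))
      ≡⟨ sumℤ-++ (map g (subsets U)) _ ⟩
    sumℤ (map g (subsets U)) + sumℤ (map g (map (u ∷_) (subsets U)))
      ≡⟨ cong (λ xs → sumℤ (map g (subsets U)) + sumℤ xs) (sym (List.map-∘ (subsets U))) ⟩
    sumℤ (map g (subsets U)) + sumℤ (map (g ∘ (u ∷_)) (subsets U)) ∎
    where open ≡-Reasoning

T-does : {P : Set} (P? : Dec P) → T (does P?) ⇔ P
T-does (yes p) = mk⇔ (const p) (const tt)
T-does (no ¬p) = mk⇔ (λ ()) ¬p

module DecSubsets {A : Set} (_≟_ : DecidableEquality A) where

  open DecMembership _≟_ using (_∈?_)

  _⊆ᵇ_ : List A → List A → Bool
  E ⊆ᵇ B = all (λ e → does (e ∈? B)) E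

  T-⊆ᵇ : {E B : List A} → T (E ⊆ᵇ B) ⇔ All (_∈ B) E
  T-⊆ᵇ {E} {B} = mk⇔ (All.map (Equivalence.to (T-does (_ ∈? B))) ∘ all⁺ _ E)
                     (all⁻ _ ∘ All.map (Equivalence.from (T-does (_ ∈? B))))

  ⊆ᵇ-∷ʳ : {u : A} {B : List A} (E : List A) → u ∉ E → E ⊆ᵇ (u ∷ B) ≡ E ⊆ᵇ B
  ⊆ᵇ-∷ʳ          []      _   = refl
  ⊆ᵇ-∷ʳ {u} {B} (e ∷ E) u∉E =
    cong₂ _∧_ (cong (_∨ does (e ∈? B)) (dec-false (e ≟ u) (u∉E ∘ here ∘ sym))) (⊆ᵇ-∷ʳ {B = B} E (u∉E ∘ there))

  sumℤ-subsets-⊆ : (f : List A → ℤ) {B U : List A} → Unique U → B ⊆ U →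
    sumℤ (map f (subsets B)) ≡ sumℤ (map (λ E → if E ⊆ᵇ B then f E else 0ℤ) (subsets U))
  sumℤ-subsets-⊆ f _ [] = refl
  sumℤ-subsets-⊆ f {B} {u ∷ U} (u∉U ∷ uniqueU) (_ ∷ʳ B⊆U) = begin
    sumℤ (map f (subsets B))
      ≡⟨ sumℤ-subsets-⊆ f uniqueU B⊆U ⟩
    sumℤ (map g (subsets U))
      ≡⟨ ℤ.+-identityʳ _ ⟨
    sumℤ (map g (subsets U)) + 0ℤ
      ≡⟨ cong (sumℤ (map g (subsets U)) +_) (sumℤ-zero (g ∘ (u ∷_)) (subsets U) excluded) ⟨
    sumℤ (map g (subsets U)) + sumℤ (map (g ∘ (u ∷_)) (subsets U))
      ≡⟨ sumℤ-subsets-∷ g u U ⟨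
    sumℤ (map g (subsets (u ∷ U))) ∎
    where
    open ≡-Reasoning
    g : List A → ℤ
    g E = if E ⊆ᵇ B then f E else 0ℤ
    excluded : ∀ {E} → E ∈ subsets U → g (u ∷ E) ≡ 0ℤ
    excluded _ rewrite dec-false (u ∈? B) (All¬⇒¬Any u∉U ∘ Sublist.lookup B⊆U) = refl
  sumℤ-subsets-⊆ f {u ∷ B} {u ∷ U} (u∉U ∷ uniqueU) (refl ∷ B⊆U) = begin
    sumℤ (map f (subsets (u ∷ B)))
      ≡⟨ sumℤ-subsets-∷ f u B ⟩
    sumℤ (map f (subsets B)) + sumℤ (map (f ∘ (u ∷_)) (subsets B))
      ≡⟨ cong₂ _+_ (sumℤ-subsets-⊆ f uniqueU B⊆U) (sumℤ-subsets-⊆ (f ∘ (u ∷_)) uniqueU B⊆U) ⟩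
    sumℤ (map (λ E → if E ⊆ᵇ B then f E else 0ℤ) (subsets U))
      + sumℤ (map (λ E → if E ⊆ᵇ B then f (u ∷ E) else 0ℤ) (subsets U))
      ≡⟨ cong₂ _+_ (sumℤ-cong (subsets U) (λ E∈ → cong (λ b → if b then _ else 0ℤ) (drop-u E∈)))
                   (sumℤ-cong (subsets U) (λ E∈ → cong (λ b → if b then _ else 0ℤ) (keep-u E∈))) ⟩
    sumℤ (map g (subsets U)) + sumℤ (map (g ∘ (u ∷_)) (subsets U))
      ≡⟨ sumℤ-subsets-∷ g u U ⟨
    sumℤ (map g (subsets (u ∷ U))) ∎
    where
    open ≡-Reasoning
    g : List A → ℤ
    g E = if E ⊆ᵇ (u ∷ B) then f E else 0ℤ
    u∉ : ∀ {E} → E ∈ subsets U → u ∉ E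
    u∉ = ∉-subsets (All¬⇒¬Any u∉U)
    drop-u : ∀ {E} → E ∈ subsets U → E ⊆ᵇ B ≡ E ⊆ᵇ (u ∷ B)
    drop-u {E} E∈ = sym (⊆ᵇ-∷ʳ {B = B} E (u∉ E∈))
    keep-u : ∀ {E} → E ∈ subsets U → E ⊆ᵇ B ≡ (u ∷ E) ⊆ᵇ (u ∷ B)
    keep-u {E} E∈ rewrite dec-true (u ∈? (u ∷ B)) (here refl) = drop-u E∈

≡ᵇ-refl : (n : ℕ) → (n ≡ᵇ n) ≡ true
≡ᵇ-refl zero    = refl
≡ᵇ-refl (suc n) = ≡ᵇ-refl n

∈-if : {A : Set} {b : Bool} {x y : A} → x ∈ (if b then [ y ] else []) → T b × x ≡ y
∈-if {b = true} (here x≡y) = tt , x≡y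

∈-if⁺ : {A : Set} {b : Bool} {y : A} → T b → y ∈ (if b then [ y ] else [])
∈-if⁺ {b = true} _ = here refl

∈⇔1≤occ : (h : ℕ) (l : List ℕ) → h ∈ l ⇔ 1 ≤ occ h l
∈⇔1≤occ h l = mk⇔ (to l) (from l)
  where
  to : (l : List ℕ) → h ∈ l → 1 ≤ occ h l
  to (k ∷ l) (here refl) rewrite ≡ᵇ-refl h = s≤s z≤n
  to (k ∷ l) (there h∈l) with h ≡ᵇ k
  ... | true  = s≤s z≤n
  ... | false = to l h∈l
  from : (l : List ℕ) → 1 ≤ occ h l → h ∈ l
  from (k ∷ l) 1≤occ with h ≡ᵇ k in h≡ᵇk
  ... | true  = here (≡ᵇ⇒≡ h k (subst T (sym h≡ᵇk) tt))
  ... | false = there (from l 1≤occ)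

double⇒∈ : {h : ℕ} (l : List ℕ) → 2 ≤ occ h l → h ∈ l
double⇒∈ {h} l 2≤occ = Equivalence.from (∈⇔1≤occ h l) (≤-pred (m≤n⇒m≤1+n 2≤occ))

T-isPart : (h : ℕ) (l : List ℕ) → T (isPart h l) ⇔ h ∈ l
T-isPart h l = mk⇔ to from
  where
  to : T (isPart h l) → h ∈ l
  to t with find (any⁻ (h ≡ᵇ_) l t)
  ... | k , k∈l , h≡ᵇk = subst (_∈ l) (sym (≡ᵇ⇒≡ h k h≡ᵇk)) k∈l
  from : h ∈ l → T (isPart h l)
  from h∈l = any⁺ (h ≡ᵇ_) (lose h∈l (≡⇒≡ᵇ h h refl))

T-isDouble : (h : ℕ) (l : List ℕ) → T (isDouble h l) ⇔ 2 ≤ occ h l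
T-isDouble h l = mk⇔ (≤ᵇ⇒≤ 2 (occ h l)) ≤⇒≤ᵇ

∈-dedup : {h : ℕ} (l : List ℕ) → h ∈ dedup l ⇔ h ∈ l
∈-dedup {h} l = mk⇔ (to l) (from l)
  where
  to : (l : List ℕ) → h ∈ dedup l → h ∈ l
  to (k ∷ l) (here h≡k) = here h≡k
  to (k ∷ l) (there h∈) = there (to l (proj₁ (∈-filter⁻ (T? ∘ (not ∘ (k ≡ᵇ_))) h∈)))
  from : (l : List ℕ) → h ∈ l → h ∈ dedup l
  from (k ∷ l) (here h≡k) = here h≡k
  from (k ∷ l) (there h∈l) with k ≟ h
  ... | yes refl = here refl
  ... | no  k≢h  = there (∈-filter⁺ (T? ∘ (not ∘ (k ≡ᵇ_))) (from l h∈l)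
                                     (Equivalence.from T-not-≡ (dec-false (k ≟ h) k≢h)))

vx∈vertsG : {h : ℕ} (l : List ℕ) → vx h ∈ vertsG l ⇔ h ∈ l
vx∈vertsG {h} l = mk⇔ to from
  where
  to : vx h ∈ vertsG l → h ∈ l
  to v∈ with find (∈-concatMap⁻ _ {xs = dedup l} v∈)
  ... | d , d∈ , here refl = Equivalence.to (∈-dedup l) d∈
  ... | d , d∈ , there v∈′ with () ← proj₂ (∈-if v∈′)
  from : h ∈ l → vx h ∈ vertsG l
  from h∈l = ∈-concatMap⁺ _ (lose (Equivalence.from (∈-dedup l) h∈l) (here refl))

vy∈vertsG : {h : ℕ} (l : List ℕ) → vy h ∈ vertsG l ⇔ 2 ≤ occ h l
vy∈vertsG {h} l = mk⇔ to from
  where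
  to : vy h ∈ vertsG l → 2 ≤ occ h l
  to v∈ with find (∈-concatMap⁻ _ {xs = dedup l} v∈)
  ... | d , _ , there v∈′ with ∈-if v∈′
  ...   | double , refl = Equivalence.to (T-isDouble h l) double
  from : 2 ≤ occ h l → vy h ∈ vertsG l
  from 2≤occ = ∈-concatMap⁺ _ (lose (Equivalence.from (∈-dedup l) (double⇒∈ l 2≤occ))
                                    (there (∈-if⁺ (Equivalence.from (T-isDouble h l) 2≤occ))))

exx∈edgesG : {k : ℕ} (l : List ℕ) → exx k ∈ edgesG l ⇔ (k ∈ l × suc k ∈ l)
exx∈edgesG {k} l = mk⇔ to from
  where
  to : exx k ∈ edgesG l → k ∈ l × suc k ∈ l
  to e∈ with find (∈-concatMap⁻ _ {xs = dedup l} e∈)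
  ... | d , d∈ , e∈′ with ∈-++⁻ (if isPart (suc d) l then [ exx d ] else []) e∈′
  ...   | inj₂ e∈″ with () ← proj₂ (∈-if e∈″)
  ...   | inj₁ e∈″ with ∈-if e∈″
  ...     | part , refl = Equivalence.to (∈-dedup l) d∈ , Equivalence.to (T-isPart (suc k) l) part
  from : k ∈ l × suc k ∈ l → exx k ∈ edgesG l
  from (k∈l , sk∈l) = ∈-concatMap⁺ _ (lose (Equivalence.from (∈-dedup l) k∈l)
                                          (∈-++⁺ˡ (∈-if⁺ (Equivalence.from (T-isPart (suc k) l) sk∈l))))

exy∈edgesG : {k : ℕ} (l : List ℕ) → exy k ∈ edgesG l ⇔ 2 ≤ occ k l
exy∈edgesG {k} l = mk⇔ to from
  where
  to : exy k ∈ edgesG l → 2 ≤ occ k l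
  to e∈ with find (∈-concatMap⁻ _ {xs = dedup l} e∈)
  ... | d , d∈ , e∈′ with ∈-++⁻ (if isPart (suc d) l then [ exx d ] else []) e∈′
  ...   | inj₁ e∈″ with () ← proj₂ (∈-if e∈″)
  ...   | inj₂ e∈″ with ∈-if e∈″
  ...     | double , refl = Equivalence.to (T-isDouble k l) double
  from : 2 ≤ occ k l → exy k ∈ edgesG l
  from 2≤occ = ∈-concatMap⁺ _ (lose (Equivalence.from (∈-dedup l) (double⇒∈ l 2≤occ))
                                    (∈-++⁺ʳ _ (∈-if⁺ (Equivalence.from (T-isDouble k l) 2≤occ))))

exx-injective : {a b : ℕ} → exx a ≡ exx b → a ≡ b
exx-injective refl = refl

exy-injective : {a b : ℕ} → exy a ≡ exy b → a ≡ b
exy-injective refl = refl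

_≟ᴱ_ : DecidableEquality GEdge
exx a ≟ᴱ exx b = map′ (cong exx) exx-injective (a ≟ b)
exx a ≟ᴱ exy b = no λ ()
exy a ≟ᴱ exx b = no λ ()
exy a ≟ᴱ exy b = map′ (cong exy) exy-injective (a ≟ b)

open DecMembership _≟ᴱ_ using (_∈?_)
open DecSubsets _≟ᴱ_ using (_⊆ᵇ_; T-⊆ᵇ; sumℤ-subsets-⊆)

endpoint∈vertsG : (l : List ℕ) {e : GEdge} {v : Vtx} → e ∈ edgesG l → T (incident v e) → v ∈ vertsG l
endpoint∈vertsG l {exx k} {vx h} e∈ inc with Equivalence.to T-∨ inc | Equivalence.to (exx∈edgesG l) e∈
... | inj₁ h≡ᵇk  | k∈l , _   rewrite ≡ᵇ⇒≡ h k h≡ᵇk        = Equivalence.from (vx∈vertsG l) k∈l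
... | inj₂ h≡ᵇsk | _ , sk∈l rewrite ≡ᵇ⇒≡ h (suc k) h≡ᵇsk = Equivalence.from (vx∈vertsG l) sk∈l
endpoint∈vertsG l {exy k} {vx h} e∈ inc rewrite ≡ᵇ⇒≡ h k inc =
  Equivalence.from (vx∈vertsG l) (double⇒∈ l (Equivalence.to (exy∈edgesG l) e∈))
endpoint∈vertsG l {exy k} {vy h} e∈ inc rewrite ≡ᵇ⇒≡ h k inc =
  Equivalence.from (vy∈vertsG l) (Equivalence.to (exy∈edgesG l) e∈)

covers : List GEdge → Vtx → Bool
covers E v = any (incident v) E

covers⁺ : (v : Vtx) {E : List GEdge} {e : GEdge} → e ∈ E → T (incident v e) → T (covers E v)
covers⁺ v e∈E inc = any⁺ (incident v) (lose e∈E inc)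

incident-exx-lower : (k : ℕ) → T (incident (vx k) (exx k))
incident-exx-lower k = Equivalence.from T-∨ (inj₁ (≡⇒≡ᵇ k k refl))

incident-exx-upper : (k : ℕ) → T (incident (vx (suc k)) (exx k))
incident-exx-upper k = Equivalence.from T-∨ (inj₂ (≡⇒≡ᵇ k k refl))

incident-exy-x : (k : ℕ) → T (incident (vx k) (exy k))
incident-exy-x k = ≡⇒≡ᵇ k k refl

incident-exy-y : (k : ℕ) → T (incident (vy k) (exy k))
incident-exy-y k = ≡⇒≡ᵇ k k refl

spans : List ℕ → List GEdge → Bool
spans l E = (E ⊆ᵇ edgesG l) ∧ spanning l E

spans⇒covers⇔∈vertsG : (l : List ℕ) (E : List GEdge) → T (spans l E) → (v : Vtx) → T (covers E v) ⇔ v ∈ vertsG l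
spans⇒covers⇔∈vertsG l E spans-lE v = mk⇔ to from
  where
  E⊆edges = proj₁ (Equivalence.to T-∧ spans-lE)
  spanning-E = proj₂ (Equivalence.to (T-∧ {E ⊆ᵇ edgesG l}) spans-lE)
  to : T (covers E v) → v ∈ vertsG l
  to c with find (any⁻ (incident v) E c)
  ... | e , e∈E , inc = endpoint∈vertsG l (All.lookup (Equivalence.to T-⊆ᵇ E⊆edges) e∈E) inc
  from : v ∈ vertsG l → T (covers E v)
  from v∈ = All.lookup (all⁺ (covers E) (vertsG l) spanning-E) v∈

coverCount : List GEdge → ℕ → ℕ
coverCount E h = (if covers E (vx h) then 1 else 0) ℕ.+ (if covers E (vy h) then 1 else 0)

covers-vy⇒covers-vx : (E : List GEdge) (h : ℕ) → T (covers E (vy h)) → T (covers E (vx h))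
covers-vy⇒covers-vx E h c with find (any⁻ (incident (vy h)) E c)
... | exy k , e∈E , inc = covers⁺ (vx h) e∈E inc

indicator-thresholds : {x y : Bool} → (T y → T x) →
  (1 ≤ (if x then 1 else 0) ℕ.+ (if y then 1 else 0) ⇔ T x) ×
  (2 ≤ (if x then 1 else 0) ℕ.+ (if y then 1 else 0) ⇔ T y)
indicator-thresholds {true}  {true}  _   = mk⇔ _ (const (s≤s z≤n)) , mk⇔ _ (const (s≤s (s≤s z≤n)))
indicator-thresholds {true}  {false} _   = mk⇔ _ (const (s≤s z≤n)) , mk⇔ (λ { (s≤s ()) }) λ ()
indicator-thresholds {false} {true}  y⇒x with () ← y⇒x tt
indicator-thresholds {false} {false} _   = mk⇔ (λ ()) (λ ()) , mk⇔ (λ ()) (λ ())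

1≤coverCount : (E : List GEdge) (h : ℕ) → 1 ≤ coverCount E h ⇔ T (covers E (vx h))
1≤coverCount E h = proj₁ (indicator-thresholds (covers-vy⇒covers-vx E h))

2≤coverCount : (E : List GEdge) (h : ℕ) → 2 ≤ coverCount E h ⇔ T (covers E (vy h))
2≤coverCount E h = proj₂ (indicator-thresholds (covers-vy⇒covers-vx E h))

coverCount≤2 : (E : List GEdge) (h : ℕ) → coverCount E h ≤ 2
coverCount≤2 E h = +-mono-≤ (indicator≤1 (covers E (vx h))) (indicator≤1 (covers E (vy h)))
  where
  indicator≤1 : (b : Bool) → (if b then 1 else 0) ≤ 1
  indicator≤1 true  = s≤s z≤n
  indicator≤1 false = z≤n

≤2-determined : {m n : ℕ} → m ≤ 2 → n ≤ 2 → (1 ≤ m ⇔ 1 ≤ n) → (2 ≤ m ⇔ 2 ≤ n) → m ≡ n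
≤2-determined {0} {0} _ _ _ _ = refl
≤2-determined {1} {1} _ _ _ _ = refl
≤2-determined {2} {2} _ _ _ _ = refl
≤2-determined {0}     {suc _} _ _ one _ with () ← Equivalence.from one (s≤s z≤n)
≤2-determined {suc _} {0}     _ _ one _ with () ← Equivalence.to one (s≤s z≤n)
≤2-determined {1} {2} _ _ _ two with s≤s () ← Equivalence.from two ≤-refl
≤2-determined {2} {1} _ _ _ two with s≤s () ← Equivalence.to two ≤-refl
≤2-determined {suc (suc (suc _))} {_} (s≤s (s≤s ())) _ _ _
≤2-determined {1} {suc (suc (suc _))} _ (s≤s (s≤s ())) _ _
≤2-determined {2} {suc (suc (suc _))} _ (s≤s (s≤s ())) _ _

spans⇒occ≡coverCount : (l : List ℕ) (E : List GEdge) → (∀ h → occ h l ≤ 2) → T (spans l E) →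
  ∀ h → occ h l ≡ coverCount E h
spans⇒occ≡coverCount l E occ≤2 spans-lE h = ≤2-determined (occ≤2 h) (coverCount≤2 E h) one two
  where
  covers⇔ = spans⇒covers⇔∈vertsG l E spans-lE
  one : 1 ≤ occ h l ⇔ 1 ≤ coverCount E h
  one = ⇔-sym (⇔-trans (1≤coverCount E h) (⇔-trans (covers⇔ (vx h)) (⇔-trans (vx∈vertsG l) (∈⇔1≤occ h l))))
  two : 2 ≤ occ h l ⇔ 2 ≤ coverCount E h
  two = ⇔-sym (⇔-trans (2≤coverCount E h) (⇔-trans (covers⇔ (vy h)) (vy∈vertsG l)))

occ≡coverCount⇒∈ : (l : List ℕ) (E : List GEdge) → (∀ h → occ h l ≡ coverCount E h) →
  ∀ {h} → T (covers E (vx h)) → h ∈ l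
occ≡coverCount⇒∈ l E occ≡ {h} c =
  Equivalence.from (∈⇔1≤occ h l) (subst (1 ≤_) (sym (occ≡ h)) (Equivalence.from (1≤coverCount E h) c))

occ≡coverCount⇒spans : (l : List ℕ) (E : List GEdge) → (∀ h → occ h l ≡ coverCount E h) → T (spans l E)
occ≡coverCount⇒spans l E occ≡ =
  Equivalence.from T-∧ (Equivalence.from T-⊆ᵇ (All.tabulate edge∈) , all⁻ _ (All.tabulate vertex-covered))
  where
  part : ∀ {h} → T (covers E (vx h)) → h ∈ l
  part = occ≡coverCount⇒∈ l E occ≡
  double : ∀ {h} → T (covers E (vy h)) → 2 ≤ occ h l
  double {h} c = subst (2 ≤_) (sym (occ≡ h)) (Equivalence.from (2≤coverCount E h) c)
  edge∈ : ∀ {e} → e ∈ E → e ∈ edgesG l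
  edge∈ {exx k} e∈E = Equivalence.from (exx∈edgesG l)
    (part (covers⁺ (vx k) e∈E (incident-exx-lower k)) , part (covers⁺ (vx (suc k)) e∈E (incident-exx-upper k)))
  edge∈ {exy k} e∈E = Equivalence.from (exy∈edgesG l) (double (covers⁺ (vy k) e∈E (incident-exy-y k)))
  vertex-covered : ∀ {v} → v ∈ vertsG l → T (covers E v)
  vertex-covered {vx h} v∈ = Equivalence.to (1≤coverCount E h)
    (subst (1 ≤_) (occ≡ h) (Equivalence.to (∈⇔1≤occ h l) (Equivalence.to (vx∈vertsG l) v∈)))
  vertex-covered {vy h} v∈ = Equivalence.to (2≤coverCount E h)
    (subst (2 ≤_) (occ≡ h) (Equivalence.to (vy∈vertsG l) v∈))

Linked≥-max : {x y : ℕ} {xs : List ℕ} → Linked _≥_ (x ∷ xs) → y ∈ x ∷ xs → y ≤ x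
Linked≥-max sorted = All.lookup (Linked⇒All (flip ≤-trans) ≤-refl sorted)

occ≡⇒∈ : {h : ℕ} {xs ys : List ℕ} → occ h xs ≡ occ h ys → h ∈ xs → h ∈ ys
occ≡⇒∈ {h} {xs} {ys} eq h∈xs =
  Equivalence.from (∈⇔1≤occ h ys) (subst (1 ≤_) eq (Equivalence.to (∈⇔1≤occ h xs) h∈xs))

sorted-occ-unique : {xs ys : List ℕ} → Linked _≥_ xs → Linked _≥_ ys → (∀ h → occ h xs ≡ occ h ys) → xs ≡ ys
sorted-occ-unique {[]}     {[]}     _ _ _ = refl
sorted-occ-unique {[]}     {b ∷ ys} _ _ occ≡ with () ← occ≡⇒∈ {xs = b ∷ ys} {ys = []} (sym (occ≡ b)) (here refl)
sorted-occ-unique {a ∷ xs} {[]}     _ _ occ≡ with () ← occ≡⇒∈ {xs = a ∷ xs} {ys = []} (occ≡ a) (here refl)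
sorted-occ-unique {a ∷ xs} {b ∷ ys} sxs sys occ≡
  with refl ← ≤-antisym (Linked≥-max sys (occ≡⇒∈ {xs = a ∷ xs} (occ≡ a) (here refl)))
                        (Linked≥-max sxs (occ≡⇒∈ {xs = b ∷ ys} (sym (occ≡ b)) (here refl)))
  = cong (a ∷_) (sorted-occ-unique (Linked.tail sxs) (Linked.tail sys) tail-occ≡)
  where
  tail-occ≡ : ∀ h → occ h xs ≡ occ h ys
  tail-occ≡ h with occ≡ h
  ... | eq with h ≡ᵇ a
  ...   | true  = suc-injective eq
  ...   | false = eq

InRange : ℕ → ℕ → ℕ → Set
InRange s K x = s ≤ x × x < s ℕ.+ K

InRange-suc : {s K x : ℕ} → InRange s K x → InRange s (suc K) x
InRange-suc {s} {K} (s≤x , x<s+K) = s≤x , ≤-trans x<s+K (+-monoʳ-≤ s (n≤1+n K))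

InRange-below-top : {s K x : ℕ} → InRange s (suc K) x → x ≢ s ℕ.+ K → InRange s K x
InRange-below-top {s} {K} {x} (s≤x , x<s+1+K) x≢top =
  s≤x , ≤∧≢⇒< (≤-pred (subst (x <_) (+-suc s K) x<s+1+K)) x≢top

InRange-zero : {s x : ℕ} → ¬ InRange s 0 x
InRange-zero {s} (s≤x , x<s+0) = <-irrefl refl (<-≤-trans (subst (_ <_) (+-identityʳ s) x<s+0) s≤x)

levels : ℕ → ℕ → List ℕ
levels s K = applyDownFrom (s ℕ.+_) K

∈levels : {s K x : ℕ} → x ∈ levels s K ⇔ InRange s K x
∈levels {s} {K} {x} = mk⇔ to from
  where
  to : x ∈ levels s K → InRange s K x
  to x∈ with applyDownFrom⁻ (s ℕ.+_) x∈
  ... | i , i<K , refl = m≤m+n s i , +-monoʳ-< s i<K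
  from : InRange s K x → x ∈ levels s K
  from (s≤x , x<s+K) = applyDownFrom⁺ (s ℕ.+_) (sym (m+[n∸m]≡n s≤x))
    (+-cancelˡ-< s _ _ (subst (_< s ℕ.+ K) (sym (m+[n∸m]≡n s≤x)) x<s+K))

level : GEdge → ℕ
level (exx t) = t
level (exy t) = t

-- Listed from the top level down, like edgesG λ for non-increasing λ, so that edgesG λ is a sublist.
levelEdges : ℕ → ℕ → List GEdge
levelEdges s K = concatMap (λ t → exx t ∷ exy t ∷ []) (levels s K)

∈levelEdges : {s K : ℕ} {e : GEdge} → e ∈ levelEdges s K ⇔ InRange s K (level e)
∈levelEdges {s} {K} {e} = mk⇔ to from
  where
  to : e ∈ levelEdges s K → InRange s K (level e)
  to e∈ with find (∈-concatMap⁻ _ {xs = levels s K} e∈)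
  ... | t , t∈ , here refl         = Equivalence.to ∈levels t∈
  ... | t , t∈ , there (here refl) = Equivalence.to ∈levels t∈
  from : InRange s K (level e) → e ∈ levelEdges s K
  from r = ∈-concatMap⁺ _ (lose (Equivalence.from ∈levels r) (at-level e))
    where
    at-level : (e : GEdge) → e ∈ exx (level e) ∷ exy (level e) ∷ []
    at-level (exx t) = here refl
    at-level (exy t) = there (here refl)

levelEdges-unique : (s K : ℕ) → Unique (levelEdges s K)
levelEdges-unique s zero    = []
levelEdges-unique s (suc K) =
  ((λ ()) ∷ All.tabulate (λ e′∈ → below-top e′∈ refl)) ∷ All.tabulate (λ e′∈ → below-top e′∈ refl)
  ∷ levelEdges-unique s K
  where
  below-top : ∀ {e′ e} → e′ ∈ levelEdges s K → level e ≡ s ℕ.+ K → e ≢ e′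
  below-top e′∈ top refl = <-irrefl top (proj₂ (Equivalence.to (∈levelEdges {s} {K}) e′∈))

∈-replicate⁻ : {A : Set} {x y : A} (n : ℕ) → x ∈ replicate n y → x ≡ y
∈-replicate⁻ (suc n) (here x≡y) = x≡y
∈-replicate⁻ (suc n) (there x∈) = ∈-replicate⁻ n x∈

occ≡0 : {h : ℕ} (l : List ℕ) → h ∉ l → occ h l ≡ 0
occ≡0 {h} l h∉l = n<1⇒n≡0 (≰⇒> (h∉l ∘ Equivalence.from (∈⇔1≤occ h l)))

occ-++ : (h : ℕ) (xs ys : List ℕ) → occ h (xs ++ ys) ≡ occ h xs ℕ.+ occ h ys
occ-++ h []       ys = refl
occ-++ h (x ∷ xs) ys with h ≡ᵇ x
... | true  = cong suc (occ-++ h xs ys)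
... | false = occ-++ h xs ys

occ-replicate : (h c : ℕ) → occ h (replicate c h) ≡ c
occ-replicate h zero    = refl
occ-replicate h (suc c) rewrite ≡ᵇ-refl h = cong suc (occ-replicate h c)

-- μ(E) restricted to the levels s, …, s + K − 1.
vertexIndices : List GEdge → ℕ → ℕ → List ℕ
vertexIndices E s K = concatMap (λ t → replicate (coverCount E t) t) (levels s K)

∈vertexIndices : (E : List GEdge) (s K : ℕ) {x : ℕ} → x ∈ vertexIndices E s K → InRange s K x
∈vertexIndices E s K x∈ with find (∈-concatMap⁻ _ {xs = levels s K} x∈)
... | t , t∈ , x∈rep rewrite ∈-replicate⁻ (coverCount E t) x∈rep = Equivalence.to ∈levels t∈

Linked≥-replicate-++ : (c t : ℕ) {rest : List ℕ} → All (_≤ t) rest → Linked _≥_ rest →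
  Linked _≥_ (replicate c t ++ rest)
Linked≥-replicate-++ zero          t _          sorted = sorted
Linked≥-replicate-++ (suc zero)    t []         _      = [-]
Linked≥-replicate-++ (suc zero)    t (r≤t ∷ _)  sorted = r≤t ∷ sorted
Linked≥-replicate-++ (suc (suc c)) t rest≤t     sorted = ≤-refl ∷ Linked≥-replicate-++ (suc c) t rest≤t sorted

vertexIndices-sorted : (E : List GEdge) (s K : ℕ) → Linked _≥_ (vertexIndices E s K)
vertexIndices-sorted E s zero    = []
vertexIndices-sorted E s (suc K) =
  Linked≥-replicate-++ (coverCount E (s ℕ.+ K)) (s ℕ.+ K)
    (All.tabulate (<⇒≤ ∘ proj₂ ∘ ∈vertexIndices E s K)) (vertexIndices-sorted E s K)

occ-vertexIndices-inRange : (E : List GEdge) {s K h : ℕ} → InRange s K h →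
  occ h (vertexIndices E s K) ≡ coverCount E h
occ-vertexIndices-inRange E {s} {zero}  h∈range with () ← InRange-zero h∈range
occ-vertexIndices-inRange E {s} {suc K} {h} h∈range
  rewrite occ-++ h (replicate (coverCount E (s ℕ.+ K)) (s ℕ.+ K)) (vertexIndices E s K)
  with h ≟ s ℕ.+ K
... | yes refl rewrite occ-replicate h (coverCount E h) =
  trans (cong (coverCount E h ℕ.+_) (occ≡0 _ (<-irrefl refl ∘ proj₂ ∘ ∈vertexIndices E s K))) (+-identityʳ _)
... | no h≢top rewrite occ≡0 (replicate (coverCount E (s ℕ.+ K)) (s ℕ.+ K)) (h≢top ∘ ∈-replicate⁻ _) =
  occ-vertexIndices-inRange E (InRange-below-top h∈range h≢top)

incident-vx-level : (h : ℕ) (e : GEdge) → T (incident (vx h) e) → h ≡ level e ⊎ h ≡ suc (level e)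
incident-vx-level h (exx k) inc with Equivalence.to T-∨ inc
... | inj₁ h≡ᵇk  = inj₁ (≡ᵇ⇒≡ h k h≡ᵇk)
... | inj₂ h≡ᵇsk = inj₂ (≡ᵇ⇒≡ h (suc k) h≡ᵇsk)
incident-vx-level h (exy k) inc = inj₁ (≡ᵇ⇒≡ h k inc)

covers-vx⇒InRange : {s K h : ℕ} (E : List GEdge) → E ⊆ levelEdges s K → T (covers E (vx h)) → InRange s (suc K) h
covers-vx⇒InRange {s} {K} {h} E E⊆ c with find (any⁻ (incident (vx h)) E c)
... | e , e∈E , inc with Equivalence.to (∈levelEdges {s} {K}) (Sublist.lookup E⊆ e∈E) | incident-vx-level h e inc
...   | range | inj₁ refl = InRange-suc range
...   | s≤t , t<s+K | inj₂ refl = ≤-trans s≤t (n≤1+n _) , subst (h <_) (sym (+-suc s K)) (s≤s t<s+K)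

coverCount≡0 : (E : List GEdge) (h : ℕ) → ¬ T (covers E (vx h)) → coverCount E h ≡ 0
coverCount≡0 E h ¬c = n<1⇒n≡0 (≰⇒> (¬c ∘ Equivalence.to (1≤coverCount E h)))

occ-vertexIndices : (E : List GEdge) (s K : ℕ) → E ⊆ levelEdges s K →
  ∀ h → occ h (vertexIndices E s (suc K)) ≡ coverCount E h
occ-vertexIndices E s K E⊆ h with (s ≤? h) ×-dec (h <? s ℕ.+ suc K)
... | yes h∈range = occ-vertexIndices-inRange E h∈range
... | no  h∉range = trans (occ≡0 _ (h∉range ∘ ∈vertexIndices E s (suc K)))
                          (sym (coverCount≡0 E h (h∉range ∘ covers-vx⇒InRange E E⊆)))

spans⇒≡vertexIndices : {i : ℕ} {l : List ℕ} (E : List GEdge) (s K : ℕ) → E ⊆ levelEdges s K →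
  InN i l → T (spans l E) → l ≡ vertexIndices E s (suc K)
spans⇒≡vertexIndices {l = l} E s K E⊆ l∈N spans-lE =
  sorted-occ-unique (InN.nonIncreasing l∈N) (vertexIndices-sorted E s (suc K))
    (λ h → trans (spans⇒occ≡coverCount l E (InN.cond2 l∈N) spans-lE h) (sym (occ-vertexIndices E s K E⊆ h)))

vertexIndices-spans : (E : List GEdge) (s K : ℕ) → E ⊆ levelEdges s K → T (spans (vertexIndices E s (suc K)) E)
vertexIndices-spans E s K E⊆ = occ≡coverCount⇒spans (vertexIndices E s (suc K)) E (occ-vertexIndices E s K E⊆)

∣n-n∣≤1 : (n : ℕ) → ∣ n - n ∣ ≤ 1
∣n-n∣≤1 n rewrite ∣n-n∣≡0 n = z≤n

∣1+n-n∣≤1 : (n : ℕ) → ∣ suc n - n ∣ ≤ 1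
∣1+n-n∣≤1 zero    = ≤-refl
∣1+n-n∣≤1 (suc n) = ∣1+n-n∣≤1 n

∣n-1+n∣≤1 : (n : ℕ) → ∣ n - suc n ∣ ≤ 1
∣n-1+n∣≤1 zero    = ≤-refl
∣n-1+n∣≤1 (suc n) = ∣n-1+n∣≤1 n

other-index : (l : List ℕ) (j : Fin (length l)) {h : ℕ} → h ∈ l → h ≢ lookup l j →
  Σ (Fin (length l)) λ k → k ≢ j × lookup l k ≡ h
other-index l j h∈l h≢ = index h∈l , (λ { refl → h≢ (lookup-index h∈l) }) , sym (lookup-index h∈l)

second-index : (l : List ℕ) (j : Fin (length l)) → 2 ≤ occ (lookup l j) l →
  Σ (Fin (length l)) λ k → k ≢ j × lookup l k ≡ lookup l j
second-index (x ∷ xs) Fin.zero 2≤occ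
  rewrite ≡ᵇ-refl x with x∈xs ← Equivalence.from (∈⇔1≤occ x xs) (≤-pred 2≤occ) =
  Fin.suc (index x∈xs) , (λ ()) , sym (lookup-index x∈xs)
second-index (x ∷ xs) (Fin.suc j) 2≤occ with lookup xs j ≡ᵇ x in eq
... | true  = Fin.zero , (λ ()) , sym (≡ᵇ⇒≡ _ x (subst T (sym eq) tt))
... | false with second-index xs j 2≤occ
...   | k , k≢j , same = Fin.suc k , k≢j ∘ Fin.suc-injective , same

neighbour-value : (l : List ℕ) (E : List GEdge) → (∀ h → occ h l ≡ coverCount E h) → {h : ℕ} → h ∈ l →
  2 ≤ occ h l ⊎ Σ ℕ λ h′ → h′ ∈ l × h′ ≢ h × ∣ h′ - h ∣ ≤ 1
neighbour-value l E occ≡ {h} h∈l with covers E (vy h) in y-covered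
... | true =
  inj₁ (subst (2 ≤_) (sym (occ≡ h)) (Equivalence.from (2≤coverCount E h) (Equivalence.from T-≡ y-covered)))
... | false with find (any⁻ (incident (vx h)) E (Equivalence.to (1≤coverCount E h)
                   (subst (1 ≤_) (occ≡ h) (Equivalence.to (∈⇔1≤occ h l) h∈l))))
...   | exy k , e∈E , inc with () ← subst T y-covered (covers⁺ (vy h) e∈E inc)
...   | exx k , e∈E , inc with incident-vx-level h (exx k) inc
...     | inj₁ refl =
  inj₂ (suc k , occ≡coverCount⇒∈ l E occ≡ (covers⁺ (vx (suc k)) e∈E (incident-exx-upper k))
              , 1+n≢n , ∣1+n-n∣≤1 k)
...     | inj₂ refl =
  inj₂ (k , occ≡coverCount⇒∈ l E occ≡ (covers⁺ (vx k) e∈E (incident-exx-lower k))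
          , 1+n≢n ∘ sym , ∣n-1+n∣≤1 k)

neighbouring-part : (l : List ℕ) (E : List GEdge) → (∀ h → occ h l ≡ coverCount E h) → (j : Fin (length l)) →
  Σ (Fin (length l)) λ k → k ≢ j × ∣ lookup l k - lookup l j ∣ ≤ 1
neighbouring-part l E occ≡ j with neighbour-value l E occ≡ (∈-lookup j)
... | inj₁ 2≤occ with k , k≢j , same ← second-index l j 2≤occ =
  k , k≢j , subst (λ t → ∣ t - lookup l j ∣ ≤ 1) (sym same) (∣n-n∣≤1 (lookup l j))
... | inj₂ (h′ , h′∈l , h′≢ , close) with k , k≢j , refl ← other-index l j h′∈l h′≢ = k , k≢j , close

∈⇒≤sum : {x : ℕ} {xs : List ℕ} → x ∈ xs → x ≤ sum xs
∈⇒≤sum {xs = y ∷ ys} (here refl) = m≤m+n y (sum ys)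
∈⇒≤sum {xs = y ∷ ys} (there x∈) = ≤-trans (∈⇒≤sum x∈) (m≤n+m (sum ys) y)

nonempty-∈ : {A : Set} {xs : List A} → xs ≢ [] → ∃ λ x → x ∈ xs
nonempty-∈ {xs = []}    []≢[] with () ← []≢[] refl
nonempty-∈ {xs = x ∷ _} _     = x , here refl

covers-level : {E : List GEdge} {e : GEdge} → e ∈ E → T (covers E (vx (level e)))
covers-level {e = exx k} e∈E = covers⁺ (vx k) e∈E (incident-exx-lower k)
covers-level {e = exy k} e∈E = covers⁺ (vx k) e∈E (incident-exy-x k)

vertexIndices∈N : (i s K : ℕ) → 1 ≤ s → 3 ∸ i ≤ s → (E : List GEdge) → E ⊆ levelEdges s K → E ≢ [] →
  InN i (vertexIndices E s (suc K))
vertexIndices∈N i s K 1≤s 3-i≤s E E⊆ E≢[] = record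
  { nonIncreasing = vertexIndices-sorted E s (suc K)
  ; positive      = All.tabulate (≤-trans 1≤s ∘ above-s)
  ; nonEmpty      = ≤-trans (≤-trans 1≤s (above-s level∈l)) (∈⇒≤sum level∈l)
  ; cond1         = neighbouring-part l E occ≡
  ; cond2         = λ h → subst (_≤ 2) (sym (occ≡ h)) (coverCount≤2 E h)
  ; cond3         = All.tabulate (≤-trans 3-i≤s ∘ above-s)
  }
  where
  l = vertexIndices E s (suc K)
  occ≡ = occ-vertexIndices E s K E⊆
  above-s : ∀ {x} → x ∈ l → s ≤ x
  above-s = proj₁ ∘ ∈vertexIndices E s (suc K)
  level∈l : level (proj₁ (nonempty-∈ E≢[])) ∈ l
  level∈l = occ≡coverCount⇒∈ l E occ≡ (covers-level (proj₂ (nonempty-∈ E≢[])))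

dedup-decreasing : (l : List ℕ) → Linked _≥_ l → AllPairs _>_ (dedup l)
dedup-decreasing []      _      = []
dedup-decreasing (h ∷ t) sorted =
  All.tabulate below-h ∷ AllPairs.filter⁺ (T? ∘ (not ∘ (h ≡ᵇ_))) (dedup-decreasing t (Linked.tail sorted))
  where
  below-h : ∀ {y} → y ∈ filterᵇ (not ∘ (h ≡ᵇ_)) (dedup t) → h > y
  below-h {y} y∈ with y∈dedup , h≢ᵇy ← ∈-filter⁻ (T? ∘ (not ∘ (h ≡ᵇ_))) {xs = dedup t} y∈ =
    ≤∧≢⇒< (Linked≥-max sorted (there (Equivalence.to (∈-dedup t) y∈dedup)))
          (λ { refl → subst (T ∘ not) (≡ᵇ-refl y) h≢ᵇy })

decreasing⊆levels : (s K : ℕ) {D : List ℕ} → AllPairs _>_ D → All (InRange s K) D → D ⊆ levels s K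
decreasing⊆levels s zero    []            []            = []
decreasing⊆levels s zero    (_ ∷ _)       (d∈ ∷ _)      with () ← InRange-zero d∈
decreasing⊆levels s (suc K) []            []            = Sublist.minimum _
decreasing⊆levels s (suc K) {d ∷ D} (D<d ∷ dec) (d∈ ∷ D∈) with d ≟ s ℕ.+ K
... | yes refl = refl ∷ decreasing⊆levels s K dec (All.zipWith (λ (d>x , x∈) → proj₁ x∈ , d>x) (D<d , D∈))
... | no  d≢top =
  (s ℕ.+ K) ∷ʳ decreasing⊆levels s K (D<d ∷ dec)
    (d∈K ∷ All.zipWith (λ (d>x , x∈) → proj₁ x∈ , <-trans d>x (proj₂ d∈K)) (D<d , D∈))
  where d∈K = InRange-below-top d∈ d≢top

concatMap-⊆ : {A B : Set} {f g : A → List B} {D R : List A} → (∀ x → f x ⊆ g x) → D ⊆ R →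
  concatMap f D ⊆ concatMap g R
concatMap-⊆ f⊆g []            = []
concatMap-⊆ {g = g} f⊆g (r ∷ʳ D⊆R) = Sublist.++⁺ˡ (g r) (concatMap-⊆ f⊆g D⊆R)
concatMap-⊆ f⊆g (refl ∷ D⊆R)  = Sublist.++⁺ (f⊆g _) (concatMap-⊆ f⊆g D⊆R)

edgesG⊆levelEdges : {i : ℕ} {l : List ℕ} → 1 ≤ 3 ∸ i → InN i l → edgesG l ⊆ levelEdges (3 ∸ i) (sum l)
edgesG⊆levelEdges {i} {l} 1≤s l∈N =
  concatMap-⊆ edges-at-level
    (decreasing⊆levels s (sum l) (dedup-decreasing l (InN.nonIncreasing l∈N))
      (All.tabulate (λ x∈ → in-range (Equivalence.to (∈-dedup l) x∈))))
  where
  s = 3 ∸ i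
  in-range : ∀ {x} → x ∈ l → InRange s (sum l) x
  in-range x∈ = All.lookup (InN.cond3 l∈N) x∈ , ≤-<-trans (∈⇒≤sum x∈) (+-monoˡ-≤ (sum l) 1≤s)
  edges-at-level : ∀ h → (if isPart (suc h) l then [ exx h ] else []) ++ (if isDouble h l then [ exy h ] else [])
                         ⊆ exx h ∷ exy h ∷ []
  edges-at-level h with isPart (suc h) l | isDouble h l
  ... | true  | true  = refl ∷ refl ∷ []
  ... | true  | false = refl ∷ exy h ∷ʳ []
  ... | false | true  = exx h ∷ʳ refl ∷ []
  ... | false | false = exx h ∷ʳ exy h ∷ʳ []

ff : Bool × Bool
ff = false , false

_∷ᵗ_ : Bool × Bool → SubG → SubG
x               ∷ᵗ (y ∷ Y) = x ∷ y ∷ Y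
(false , false) ∷ᵗ []      = []
(false , true)  ∷ᵗ []      = (false , true) ∷ []
(true  , b)     ∷ᵗ []      = (true , b) ∷ []

trim : SubG → SubG
trim []      = []
trim (x ∷ X) = x ∷ᵗ trim X

canonical-[] : Canonical []
canonical-[] (H , []≡H++ff) with () ← List.++-conicalʳ H [ ff ] (sym []≡H++ff)

canonical-[_] : {x : Bool × Bool} → x ≢ ff → Canonical [ x ]
canonical-[ x≢ff ] ([]    , refl) = x≢ff refl
canonical-[ x≢ff ] (_ ∷ H , eq)   = canonical-[] (H , List.∷-injectiveʳ eq)

∷ᵗ-canonical : (x : Bool × Bool) (Y : SubG) → Canonical Y → Canonical (x ∷ᵗ Y)
∷ᵗ-canonical x               (y ∷ Y) cY ([]    , ())
∷ᵗ-canonical x               (y ∷ Y) cY (_ ∷ H , eq) = cY (H , List.∷-injectiveʳ eq)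
∷ᵗ-canonical (false , false) []      _  = canonical-[]
∷ᵗ-canonical (false , true)  []      _  = canonical-[ (λ ()) ]
∷ᵗ-canonical (true  , b)     []      _  = canonical-[ (λ ()) ]

trim-canonical : (X : SubG) → Canonical (trim X)
trim-canonical []      = canonical-[]
trim-canonical (x ∷ X) = ∷ᵗ-canonical x (trim X) (trim-canonical X)

canonical-tail : {x : Bool × Bool} {X : SubG} → Canonical (x ∷ X) → Canonical X
canonical-tail {x} cX (H , eq) = cX (x ∷ H , cong (x ∷_) eq)

trim-id : (X : SubG) → Canonical X → trim X ≡ X
trim-id []      _  = refl
trim-id (x ∷ X) cX rewrite trim-id X (canonical-tail cX) = ∷ᵗ-id x X cX
  where
  ∷ᵗ-id : (x : Bool × Bool) (Y : SubG) → Canonical (x ∷ Y) → x ∷ᵗ Y ≡ x ∷ Y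
  ∷ᵗ-id x               (y ∷ Y) _  = refl
  ∷ᵗ-id (false , false) []      cX with () ← cX ([] , refl)
  ∷ᵗ-id (false , true)  []      _  = refl
  ∷ᵗ-id (true  , b)     []      _  = refl

trim-padding : (X : SubG) (m : ℕ) → trim (X ++ replicate m ff) ≡ trim X
trim-padding []      zero    = refl
trim-padding []      (suc m) rewrite trim-padding [] m = refl
trim-padding (x ∷ X) m       rewrite trim-padding X m  = refl

trim-padded : (X : SubG) → Σ ℕ λ m → X ≡ trim X ++ replicate m ff
trim-padded []      = 0 , refl
trim-padded (x ∷ X) with trim X | trim-padded X
... | y ∷ Y | m , X≡ = m , cong (x ∷_) X≡
... | []    | m , X≡ = last x
  where
  last : (x : Bool × Bool) → Σ ℕ λ m′ → x ∷ X ≡ x ∷ᵗ [] ++ replicate m′ ff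
  last (false , false) = suc m , cong (ff ∷_) X≡
  last (false , true)  = m , cong ((false , true) ∷_) X≡
  last (true  , b)     = m , cong ((true , b) ∷_) X≡

trim-injective : {X Y : SubG} → length X ≡ length Y → trim X ≡ trim Y → X ≡ Y
trim-injective {X} {Y} |X|≡|Y| trim≡ with trim-padded X | trim-padded Y
... | m , X≡ | m′ , Y≡ = begin
  X                              ≡⟨ X≡ ⟩
  trim X ++ replicate m ff       ≡⟨ cong₂ (λ Z k → Z ++ replicate k ff) trim≡ m≡m′ ⟩
  trim Y ++ replicate m′ ff      ≡⟨ Y≡ ⟨
  Y                              ∎
  where
  open ≡-Reasoning
  |padded| : (Z : SubG) (k : ℕ) → Z ≡ trim Z ++ replicate k ff → length Z ≡ length (trim Z) ℕ.+ k
  |padded| Z k Z≡ = trans (cong length Z≡)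
    (trans (List.length-++ (trim Z)) (cong (length (trim Z) ℕ.+_) (List.length-replicate k)))
  m≡m′ : m ≡ m′
  m≡m′ = +-cancelˡ-≡ (length (trim X)) m m′ (begin
    length (trim X) ℕ.+ m    ≡⟨ |padded| X m X≡ ⟨
    length X                 ≡⟨ |X|≡|Y| ⟩
    length Y                 ≡⟨ |padded| Y m′ Y≡ ⟩
    length (trim Y) ℕ.+ m′   ≡⟨ cong (λ Z → length Z ℕ.+ m′) trim≡ ⟨
    length (trim X) ℕ.+ m′   ∎)

wt-trim : (j : ℕ) (p : Bool) (X : SubG) → wt j p (trim X) ≡ wt j p X
wt-trim j p []            = refl
wt-trim j p ((a , b) ∷ X) =
  trans (wt-∷ᵗ p (a , b) (trim X))
        (cong ((if p ∨ a ∨ b then j else 0) ℕ.+ (if b then j else 0) ℕ.+_) (wt-trim (suc j) a X))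
  where
  wt-∷ᵗ : (p : Bool) (x : Bool × Bool) (Y : SubG) → wt j p (x ∷ᵗ Y) ≡ wt j p (x ∷ Y)
  wt-∷ᵗ p     x               (y ∷ Y) = refl
  wt-∷ᵗ false (false , false) []      = refl
  wt-∷ᵗ true  (false , false) []      = sym (trans (+-identityʳ _) (+-identityʳ j))
  wt-∷ᵗ p     (false , true)  []      = refl
  wt-∷ᵗ p     (true  , b)     []      = refl

nEdges-trim : (X : SubG) → nEdges (trim X) ≡ nEdges X
nEdges-trim []            = refl
nEdges-trim ((a , b) ∷ X) =
  trans (nEdges-∷ᵗ (a , b) (trim X)) (cong ((if a then 1 else 0) ℕ.+ (if b then 1 else 0) ℕ.+_) (nEdges-trim X))
  where
  nEdges-∷ᵗ : (x : Bool × Bool) (Y : SubG) → nEdges (x ∷ᵗ Y) ≡ nEdges (x ∷ Y)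
  nEdges-∷ᵗ x               (y ∷ Y) = refl
  nEdges-∷ᵗ (false , false) []      = refl
  nEdges-∷ᵗ (false , true)  []      = refl
  nEdges-∷ᵗ (true  , b)     []      = refl

_∈ᵇ_ : GEdge → List GEdge → Bool
e ∈ᵇ E = does (e ∈? E)

edgesAt : List GEdge → ℕ → Bool × Bool
edgesAt E j = exx j ∈ᵇ E , exy j ∈ᵇ E

-- The encoding of E in the statement, for levels j, …, j + K − 1.
profile : List GEdge → ℕ → ℕ → SubG
profile E j zero    = []
profile E j (suc K) = edgesAt E j ∷ profile E (suc j) K

length-profile : (E : List GEdge) (j K : ℕ) → length (profile E j K) ≡ K
length-profile E j zero    = refl
length-profile E j (suc K) = cong suc (length-profile E (suc j) K)

entry : SubG → ℕ → Bool × Bool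
entry []      _       = ff
entry (x ∷ X) zero    = x
entry (x ∷ X) (suc k) = entry X k

entry-profile : (E : List GEdge) (j K k : ℕ) → k < K → entry (profile E j K) k ≡ edgesAt E (j ℕ.+ k)
entry-profile E j (suc K) zero    _         = cong (edgesAt E) (sym (+-identityʳ j))
entry-profile E j (suc K) (suc k) (s≤s k<K) =
  trans (entry-profile E (suc j) K k k<K) (cong (edgesAt E) (sym (+-suc j k)))

entry-padding : (X : SubG) (m k : ℕ) → entry (X ++ replicate m ff) k ≡ entry X k
entry-padding []      zero    k       = refl
entry-padding []      (suc m) zero    = refl
entry-padding []      (suc m) (suc k) = entry-padding [] m k
entry-padding (x ∷ X) m       zero    = refl
entry-padding (x ∷ X) m       (suc k) = entry-padding X m k

entry-ext : (X Y : SubG) → length X ≡ length Y → (∀ k → k < length X → entry X k ≡ entry Y k) → X ≡ Y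
entry-ext []      []      _      _       = refl
entry-ext (x ∷ X) (y ∷ Y) |X|≡|Y| entries =
  cong₂ _∷_ (entries 0 (s≤s z≤n))
            (entry-ext X Y (suc-injective |X|≡|Y|) (λ k k<|X| → entries (suc k) (s≤s k<|X|)))

∈ᵇ-filter : (e : GEdge) (p : GEdge → Bool) (U : List GEdge) → e ∈ᵇ filterᵇ p U ≡ (e ∈ᵇ U) ∧ p e
∈ᵇ-filter e p U = does-⇔ (mk⇔ (∈-filter⁻ (T? ∘ p)) (λ (e∈U , pe) → ∈-filter⁺ (T? ∘ p) e∈U pe))
                         (e ∈? filterᵇ p U) ((e ∈? U) ×-dec T? (p e))

chosen : ℕ → SubG → GEdge → Bool
chosen s H (exx t) = proj₁ (entry H (t ∸ s))
chosen s H (exy t) = proj₂ (entry H (t ∸ s))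

profile-chosen : (s K : ℕ) (H : SubG) → length H ≤ K →
  profile (filterᵇ (chosen s H) (levelEdges s K)) s K ≡ H ++ replicate (K ∸ length H) ff
profile-chosen s K H |H|≤K = entry-ext _ _ lengths entries
  where
  E = filterᵇ (chosen s H) (levelEdges s K)
  lengths : length (profile E s K) ≡ length (H ++ replicate (K ∸ length H) ff)
  lengths = begin
    length (profile E s K)
      ≡⟨ length-profile E s K ⟩
    K
      ≡⟨ m+[n∸m]≡n |H|≤K ⟨
    length H ℕ.+ (K ∸ length H)
      ≡⟨ cong (length H ℕ.+_) (List.length-replicate (K ∸ length H)) ⟨
    length H ℕ.+ length (replicate (K ∸ length H) ff)
      ≡⟨ List.length-++ H ⟨
    length (H ++ replicate (K ∸ length H) ff) ∎
    where open ≡-Reasoning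
  chosen-at : (e : GEdge) → InRange s K (level e) → e ∈ᵇ E ≡ chosen s H e
  chosen-at e e∈range rewrite ∈ᵇ-filter e (chosen s H) (levelEdges s K)
    | dec-true (e ∈? levelEdges s K) (Equivalence.from ∈levelEdges e∈range) = refl
  entries : ∀ k → k < length (profile E s K) →
            entry (profile E s K) k ≡ entry (H ++ replicate (K ∸ length H) ff) k
  entries k k<|p| with k<K ← subst (k <_) (length-profile E s K) k<|p| = begin
    entry (profile E s K) k                       ≡⟨ entry-profile E s K k k<K ⟩
    edgesAt E (s ℕ.+ k)                           ≡⟨ cong₂ _,_ (chosen-at (exx (s ℕ.+ k)) s+k∈range)
                                                               (chosen-at (exy (s ℕ.+ k)) s+k∈range) ⟩
    entry H (s ℕ.+ k ∸ s)                         ≡⟨ cong (entry H) (m+n∸m≡n s k) ⟩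
    entry H k                                     ≡⟨ entry-padding H (K ∸ length H) k ⟨
    entry (H ++ replicate (K ∸ length H) ff) k    ∎
    where
    open ≡-Reasoning
    s+k∈range = m≤m+n s k , +-monoʳ-< s k<K

wt-head : (j : ℕ) (p a b : Bool) (H : SubG) → T (p ∨ a ∨ b) → j ≤ wt j p ((a , b) ∷ H)
wt-head j p a b H covered with p ∨ a ∨ b
... | true = ≤-trans (m≤m+n j _) (m≤m+n _ (wt (suc j) a H))

-- The last level of a canonical H carries a vertex, whose index is at least j + length H − 1.
wt-bound : (j : ℕ) (p : Bool) (x : Bool × Bool) (H : SubG) → Canonical (x ∷ H) → length H ℕ.+ j ≤ wt j p (x ∷ H)
wt-bound j p (a , b) (y ∷ H) cH = begin
  suc (length H) ℕ.+ j        ≡⟨ +-suc (length H) j ⟨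
  length H ℕ.+ suc j          ≤⟨ wt-bound (suc j) a y H (canonical-tail cH) ⟩
  wt (suc j) a (y ∷ H)        ≤⟨ m≤n+m _ ((if p ∨ a ∨ b then j else 0) ℕ.+ (if b then j else 0)) ⟩
  wt j p ((a , b) ∷ y ∷ H)    ∎
  where open ≤-Reasoning
wt-bound j p (false , false) [] cH with () ← cH ([] , refl)
wt-bound j p (false , true)  [] _  = wt-head j p false true [] (Equivalence.from (T-∨ {p}) (inj₂ tt))
wt-bound j p (true  , b)     [] _  = wt-head j p true b [] (Equivalence.from (T-∨ {p}) (inj₂ tt))

length≤wt : (j : ℕ) → 1 ≤ j → (H : SubG) → Canonical H → length H ≤ wt j false H
length≤wt j 1≤j []      _  = z≤n
length≤wt j 1≤j (x ∷ H) cH = ≤-trans (subst (_≤ length H ℕ.+ j) (+-comm (length H) 1) (+-monoʳ-≤ (length H) 1≤j))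
                                     (wt-bound j false x H cH)

profile-surjective : (s n : ℕ) → 1 ≤ s → (H : SubG) → Canonical H → wt s false H ≡ n →
  Σ (List GEdge) λ E → E ⊆ levelEdges s n × trim (profile E s n) ≡ H
profile-surjective s n 1≤s H cH wt≡n = E , Sublist.filter-⊆ (T? ∘ chosen s H) (levelEdges s n) , (begin
  trim (profile E s n)                       ≡⟨ cong trim (profile-chosen s n H |H|≤n) ⟩
  trim (H ++ replicate (n ∸ length H) ff)    ≡⟨ trim-padding H (n ∸ length H) ⟩
  trim H                                     ≡⟨ trim-id H cH ⟩
  H                                          ∎)
  where
  open ≡-Reasoning
  E = filterᵇ (chosen s H) (levelEdges s n)
  |H|≤n = subst (length H ≤_) wt≡n (length≤wt s 1≤s H cH)

edgesAt-entry : (E : List GEdge) (s K t : ℕ) → InRange s K t → edgesAt E t ≡ entry (profile E s K) (t ∸ s)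
edgesAt-entry E s K t (s≤t , t<s+K) = trans (cong (edgesAt E) (sym (m+[n∸m]≡n s≤t)))
  (sym (entry-profile E s K (t ∸ s) (+-cancelˡ-< s _ _ (subst (_< s ℕ.+ K) (sym (m+[n∸m]≡n s≤t)) t<s+K))))

edgesAt⇒∈ᵇ : {E E′ : List GEdge} (e : GEdge) → edgesAt E (level e) ≡ edgesAt E′ (level e) → e ∈ᵇ E ≡ e ∈ᵇ E′
edgesAt⇒∈ᵇ (exx t) = cong proj₁
edgesAt⇒∈ᵇ (exy t) = cong proj₂

profile-injective : (s K : ℕ) {E₁ E₂ : List GEdge} → E₁ ⊆ levelEdges s K → E₂ ⊆ levelEdges s K →
  profile E₁ s K ≡ profile E₂ s K → E₁ ≡ E₂
profile-injective s K E₁⊆ E₂⊆ eq =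
  ⊆-unique-ext (levelEdges-unique s K) E₁⊆ E₂⊆ (transfer E₁⊆ eq) (transfer E₂⊆ (sym eq))
  where
  transfer : ∀ {E E′} → E ⊆ levelEdges s K → profile E s K ≡ profile E′ s K → ∀ {e} → e ∈ E → e ∈ E′
  transfer {E} {E′} E⊆ eq {e} e∈E = Equivalence.to (T-does (e ∈? E′))
    (subst T (edgesAt⇒∈ᵇ {E} {E′} e same-level) (Equivalence.from (T-does (e ∈? E)) e∈E))
    where
    range = Equivalence.to ∈levelEdges (Sublist.lookup E⊆ e∈E)
    same-level : edgesAt E (level e) ≡ edgesAt E′ (level e)
    same-level = trans (edgesAt-entry E s K _ range)
                       (trans (cong (λ X → entry X (level e ∸ s)) eq) (sym (edgesAt-entry E′ s K _ range)))

∈ᵇ-outside : (s K : ℕ) {E : List GEdge} → E ⊆ levelEdges s K →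
  (e : GEdge) → ¬ InRange s K (level e) → e ∈ᵇ E ≡ false
∈ᵇ-outside s K {E} E⊆ e e∉range = dec-false (e ∈? E) (e∉range ∘ Equivalence.to ∈levelEdges ∘ Sublist.lookup E⊆)

∈ᵇ-++-other : {t : ℕ} {e : GEdge} (top E : List GEdge) → All (λ x → level x ≡ t) top → level e ≢ t →
  e ∈ᵇ (top ++ E) ≡ e ∈ᵇ E
∈ᵇ-++-other          []        E _                _      = refl
∈ᵇ-++-other {e = e} (x ∷ top) E (level-x ∷ levels) e≢t
  rewrite dec-false (e ≟ᴱ x) (λ e≡x → e≢t (trans (cong level e≡x) level-x)) = ∈ᵇ-++-other top E levels e≢t

profile-snoc : (E : List GEdge) (j K : ℕ) → profile E j (suc K) ≡ profile E j K ++ [ edgesAt E (j ℕ.+ K) ]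
profile-snoc E j zero    rewrite +-identityʳ j = refl
profile-snoc E j (suc K) rewrite +-suc j K     = cong (edgesAt E j ∷_) (profile-snoc E (suc j) K)

profile-cong : (E₁ E₂ : List GEdge) (j K : ℕ) → (∀ t → t < j ℕ.+ K → edgesAt E₁ t ≡ edgesAt E₂ t) →
  profile E₁ j K ≡ profile E₂ j K
profile-cong E₁ E₂ j zero    _    = refl
profile-cong E₁ E₂ j (suc K) same =
  cong₂ _∷_ (same j (subst (j <_) (sym (+-suc j K)) (s≤s (m≤m+n j K))))
            (profile-cong E₁ E₂ (suc j) K (λ t t< → same t (subst (t <_) (sym (+-suc j K)) t<)))

nEdges-++ : (X Y : SubG) → nEdges (X ++ Y) ≡ nEdges X ℕ.+ nEdges Y
nEdges-++ []            Y = refl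
nEdges-++ ((a , b) ∷ X) Y rewrite nEdges-++ X Y =
  sym (+-assoc ((if a then 1 else 0) ℕ.+ (if b then 1 else 0)) _ _)

profile-with-top : (s K : ℕ) (top : List GEdge) {E : List GEdge} → All (λ x → level x ≡ s ℕ.+ K) top →
  E ⊆ levelEdges s K → nEdges [ edgesAt (top ++ E) (s ℕ.+ K) ] ≡ length top →
  nEdges (profile (top ++ E) s (suc K)) ≡ length top ℕ.+ nEdges (profile E s K)
profile-with-top s K top {E} top-levels E⊆ top-count = begin
  nEdges (profile (top ++ E) s (suc K))
    ≡⟨ cong nEdges (profile-snoc (top ++ E) s K) ⟩
  nEdges (profile (top ++ E) s K ++ [ edgesAt (top ++ E) (s ℕ.+ K) ])
    ≡⟨ nEdges-++ (profile (top ++ E) s K) _ ⟩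
  nEdges (profile (top ++ E) s K) ℕ.+ nEdges [ edgesAt (top ++ E) (s ℕ.+ K) ]
    ≡⟨ cong₂ ℕ._+_ (cong nEdges (profile-cong (top ++ E) E s K below)) top-count ⟩
  nEdges (profile E s K) ℕ.+ length top
    ≡⟨ +-comm (nEdges (profile E s K)) (length top) ⟩
  length top ℕ.+ nEdges (profile E s K) ∎
  where
  open ≡-Reasoning
  below : ∀ t → t < s ℕ.+ K → edgesAt (top ++ E) t ≡ edgesAt E t
  below t t<top =
    cong₂ _,_ (∈ᵇ-++-other top E top-levels (<⇒≢ t<top)) (∈ᵇ-++-other top E top-levels (<⇒≢ t<top))

nEdges-profile : (s K : ℕ) {E : List GEdge} → E ⊆ levelEdges s K → nEdges (profile E s K) ≡ length E
nEdges-profile s zero    [] = refl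
nEdges-profile s (suc K) {E} (_ ∷ʳ (_ ∷ʳ E⊆)) =
  trans (profile-with-top s K [] [] E⊆ count) (nEdges-profile s K E⊆)
  where
  count : nEdges [ edgesAt E (s ℕ.+ K) ] ≡ 0
  count rewrite ∈ᵇ-outside s K E⊆ (exx (s ℕ.+ K)) (<-irrefl refl ∘ proj₂)
              | ∈ᵇ-outside s K E⊆ (exy (s ℕ.+ K)) (<-irrefl refl ∘ proj₂) = refl
nEdges-profile s (suc K) {_ ∷ E} (_ ∷ʳ (refl ∷ E⊆)) =
  trans (profile-with-top s K [ exy (s ℕ.+ K) ] (refl ∷ []) E⊆ count) (cong suc (nEdges-profile s K E⊆))
  where
  count : nEdges [ edgesAt (exy (s ℕ.+ K) ∷ E) (s ℕ.+ K) ] ≡ 1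
  count rewrite ∈ᵇ-outside s K E⊆ (exx (s ℕ.+ K)) (<-irrefl refl ∘ proj₂) | ≡ᵇ-refl (s ℕ.+ K) = refl
nEdges-profile s (suc K) {_ ∷ E} (refl ∷ (_ ∷ʳ E⊆)) =
  trans (profile-with-top s K [ exx (s ℕ.+ K) ] (refl ∷ []) E⊆ count) (cong suc (nEdges-profile s K E⊆))
  where
  count : nEdges [ edgesAt (exx (s ℕ.+ K) ∷ E) (s ℕ.+ K) ] ≡ 1
  count rewrite ∈ᵇ-outside s K E⊆ (exy (s ℕ.+ K)) (<-irrefl refl ∘ proj₂) | ≡ᵇ-refl (s ℕ.+ K) = refl
nEdges-profile s (suc K) {_ ∷ _ ∷ E} (refl ∷ (refl ∷ E⊆)) =
  trans (profile-with-top s K (exx (s ℕ.+ K) ∷ exy (s ℕ.+ K) ∷ []) (refl ∷ refl ∷ []) E⊆ count)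
        (cong (suc ∘ suc) (nEdges-profile s K E⊆))
  where
  count : nEdges [ edgesAt (exx (s ℕ.+ K) ∷ exy (s ℕ.+ K) ∷ E) (s ℕ.+ K) ] ≡ 2
  count rewrite ≡ᵇ-refl (s ℕ.+ K) = refl

incident-vx-suc : (k : ℕ) (e : GEdge) →
  incident (vx (suc k)) e ≡ does (exx k ≟ᴱ e) ∨ (does (exx (suc k) ≟ᴱ e) ∨ does (exy (suc k) ≟ᴱ e))
incident-vx-suc k (exx m) =
  trans (∨-comm (suc k ≡ᵇ m) (k ≡ᵇ m)) (cong ((k ≡ᵇ m) ∨_) (sym (∨-identityʳ (suc k ≡ᵇ m))))
incident-vx-suc k (exy m) = refl

covers-vx-suc : (E : List GEdge) (k : ℕ) →
  covers E (vx (suc k)) ≡ exx k ∈ᵇ E ∨ (exx (suc k) ∈ᵇ E ∨ exy (suc k) ∈ᵇ E)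
covers-vx-suc []      k = refl
covers-vx-suc (e ∷ E) k = begin
  incident (vx (suc k)) e ∨ covers E (vx (suc k))
    ≡⟨ cong₂ _∨_ (incident-vx-suc k e) (covers-vx-suc E k) ⟩
  (d₁ ∨ (d₂ ∨ d₃)) ∨ (exx k ∈ᵇ E ∨ (exx (suc k) ∈ᵇ E ∨ exy (suc k) ∈ᵇ E))
    ≡⟨ ∨-interchange d₁ (d₂ ∨ d₃) _ _ ⟩
  (d₁ ∨ exx k ∈ᵇ E) ∨ ((d₂ ∨ d₃) ∨ (exx (suc k) ∈ᵇ E ∨ exy (suc k) ∈ᵇ E))
    ≡⟨ cong ((d₁ ∨ exx k ∈ᵇ E) ∨_) (∨-interchange d₂ d₃ _ _) ⟩
  (d₁ ∨ exx k ∈ᵇ E) ∨ ((d₂ ∨ exx (suc k) ∈ᵇ E) ∨ (d₃ ∨ exy (suc k) ∈ᵇ E)) ∎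
  where
  open ≡-Reasoning
  d₁ = does (exx k ≟ᴱ e)
  d₂ = does (exx (suc k) ≟ᴱ e)
  d₃ = does (exy (suc k) ≟ᴱ e)

covers-vy : (E : List GEdge) (k : ℕ) → covers E (vy k) ≡ exy k ∈ᵇ E
covers-vy []          k = refl
covers-vy (exx m ∷ E) k = covers-vy E k
covers-vy (exy m ∷ E) k = cong ((k ≡ᵇ m) ∨_) (covers-vy E k)

levels-bottom : (j K : ℕ) → levels j (suc K) ≡ levels (suc j) K ++ [ j ]
levels-bottom j zero    = cong [_] (+-identityʳ j)
levels-bottom j (suc K) = cong₂ _∷_ (+-suc j K) (levels-bottom j K)

sum-replicate : (c t : ℕ) → sum (replicate c t) ≡ c ℕ.* t
sum-replicate zero    t = refl
sum-replicate (suc c) t = cong (t ℕ.+_) (sum-replicate c t)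

sum-vertexIndices-bottom : (E : List GEdge) (j K : ℕ) →
  sum (vertexIndices E j (suc K)) ≡ coverCount E j ℕ.* j ℕ.+ sum (vertexIndices E (suc j) K)
sum-vertexIndices-bottom E j K = begin
  sum (concatMap atLevel (levels j (suc K)))
    ≡⟨ cong (sum ∘ concatMap atLevel) (levels-bottom j K) ⟩
  sum (concatMap atLevel (levels (suc j) K ++ [ j ]))
    ≡⟨ cong sum (List.concatMap-++ atLevel (levels (suc j) K) [ j ]) ⟩
  sum (vertexIndices E (suc j) K ++ atLevel j ++ [])
    ≡⟨ sum-++ (vertexIndices E (suc j) K) _ ⟩
  sum (vertexIndices E (suc j) K) ℕ.+ sum (atLevel j ++ [])
    ≡⟨ cong (sum (vertexIndices E (suc j) K) ℕ.+_)
            (trans (cong sum (List.++-identityʳ (atLevel j))) (sum-replicate (coverCount E j) j)) ⟩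
  sum (vertexIndices E (suc j) K) ℕ.+ coverCount E j ℕ.* j
    ≡⟨ +-comm (sum (vertexIndices E (suc j) K)) _ ⟩
  coverCount E j ℕ.* j ℕ.+ sum (vertexIndices E (suc j) K) ∎
  where
  open ≡-Reasoning
  atLevel : ℕ → List ℕ
  atLevel t = replicate (coverCount E t) t

indicators-* : (x y : Bool) (j : ℕ) →
  ((if x then 1 else 0) ℕ.+ (if y then 1 else 0)) ℕ.* j ≡ (if x then j else 0) ℕ.+ (if y then j else 0)
indicators-* true  true  j = cong (j ℕ.+_) (+-identityʳ j)
indicators-* true  false j = refl
indicators-* false true  j = +-identityʳ j
indicators-* false false j = refl

coverCount-*-suc : (E : List GEdge) (k : ℕ) → coverCount E (suc k) ℕ.* suc k ≡
  (if exx k ∈ᵇ E ∨ (exx (suc k) ∈ᵇ E ∨ exy (suc k) ∈ᵇ E) then suc k else 0) ℕ.+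
  (if exy (suc k) ∈ᵇ E then suc k else 0)
coverCount-*-suc E k rewrite sym (covers-vx-suc E k) | sym (covers-vy E (suc k)) =
  indicators-* (covers E (vx (suc k))) (covers E (vy (suc k))) (suc k)

wt-profile : (E : List GEdge) (k K : ℕ) → exx (suc k ℕ.+ K) ∈ᵇ E ≡ false → exy (suc k ℕ.+ K) ∈ᵇ E ≡ false →
  wt (suc k) (exx k ∈ᵇ E) (profile E (suc k) K) ≡ sum (vertexIndices E (suc k) (suc K))
wt-profile E k zero exx∉ exy∉
  rewrite sum-vertexIndices-bottom E (suc k) 0 | coverCount-*-suc E k
        | subst (λ t → exx t ∈ᵇ E ≡ false) (+-identityʳ (suc k)) exx∉
        | subst (λ t → exy t ∈ᵇ E ≡ false) (+-identityʳ (suc k)) exy∉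
  with exx k ∈ᵇ E
... | true  = sym (trans (+-identityʳ _) (+-identityʳ _))
... | false = refl
wt-profile E k (suc K) exx∉ exy∉ = begin
  wt (suc k) (exx k ∈ᵇ E) (profile E (suc k) (suc K))
    ≡⟨ cong₂ ℕ._+_ (sym (coverCount-*-suc E k))
                   (wt-profile E (suc k) K (subst (λ t → exx t ∈ᵇ E ≡ false) (+-suc (suc k) K) exx∉)
                                           (subst (λ t → exy t ∈ᵇ E ≡ false) (+-suc (suc k) K) exy∉)) ⟩
  coverCount E (suc k) ℕ.* suc k ℕ.+ sum (vertexIndices E (suc (suc k)) (suc K))
    ≡⟨ sum-vertexIndices-bottom E (suc k) (suc K) ⟨
  sum (vertexIndices E (suc k) (suc (suc K))) ∎
  where open ≡-Reasoning

wt-profile-from : (s K : ℕ) → 1 ≤ s → (E : List GEdge) → E ⊆ levelEdges s K →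
  wt s false (profile E s K) ≡ sum (vertexIndices E s (suc K))
wt-profile-from (suc k) K _ E E⊆ = begin
  wt (suc k) false (profile E (suc k) K)
    ≡⟨ cong (λ p → wt (suc k) p (profile E (suc k) K))
            (sym (∈ᵇ-outside (suc k) K E⊆ (exx k) (<-irrefl refl ∘ proj₁))) ⟩
  wt (suc k) (exx k ∈ᵇ E) (profile E (suc k) K)
    ≡⟨ wt-profile E k K (∈ᵇ-outside (suc k) K E⊆ (exx (suc k ℕ.+ K)) (<-irrefl refl ∘ proj₂))
                        (∈ᵇ-outside (suc k) K E⊆ (exy (suc k ℕ.+ K)) (<-irrefl refl ∘ proj₂)) ⟩
  sum (vertexIndices E (suc k) (suc K)) ∎
  where open ≡-Reasoning

incrementHead : List ℕ → List ℕ
incrementHead []       = []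
incrementHead (x ∷ xs) = suc x ∷ xs

-- Indexed by m, it lists the compositions of suc m.
compositions⁺ : ℕ → List (List ℕ)
compositions⁺ zero    = [ [ 1 ] ]
compositions⁺ (suc m) = map (1 ∷_) (compositions⁺ m) ++ map incrementHead (compositions⁺ m)

compositions : ℕ → List (List ℕ)
compositions zero    = [ [] ]
compositions (suc m) = compositions⁺ m

compositions⁺-sound : (m : ℕ) {l : List ℕ} → l ∈ compositions⁺ m → All (1 ≤_) l × sum l ≡ suc m
compositions⁺-sound zero    (here refl) = s≤s z≤n ∷ [] , refl
compositions⁺-sound (suc m) l∈ with ∈-++⁻ (map (1 ∷_) (compositions⁺ m)) l∈
... | inj₁ l∈₁ with l′ , l′∈ , refl ← ∈-map⁻ (1 ∷_) l∈₁ with positive , sum≡ ← compositions⁺-sound m l′∈ =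
  s≤s z≤n ∷ positive , cong suc sum≡
... | inj₂ l∈₂ with ∈-map⁻ incrementHead l∈₂
...   | [] , l′∈ , refl with () ← proj₂ (compositions⁺-sound m l′∈)
...   | x ∷ xs , l′∈ , refl with _ ∷ positive , sum≡ ← compositions⁺-sound m l′∈ =
  s≤s z≤n ∷ positive , cong suc sum≡

positive-sum-zero : (l : List ℕ) → All (1 ≤_) l → sum l ≡ 0 → l ≡ []
positive-sum-zero []      _              _  = refl
positive-sum-zero (x ∷ l) (s≤s _ ∷ _)    ()

compositions⁺-complete : (m : ℕ) (l : List ℕ) → All (1 ≤_) l → sum l ≡ suc m → l ∈ compositions⁺ m
compositions⁺-complete m       (0 ∷ xs)           (() ∷ _)     _
compositions⁺-complete zero    (1 ∷ xs)           (_ ∷ pos)    sum≡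
  rewrite positive-sum-zero xs pos (suc-injective sum≡) = here refl
compositions⁺-complete zero    (suc (suc x) ∷ xs) _            ()
compositions⁺-complete (suc m) (1 ∷ xs)           (_ ∷ pos)    sum≡ =
  ∈-++⁺ˡ (∈-map⁺ (1 ∷_) (compositions⁺-complete m xs pos (suc-injective sum≡)))
compositions⁺-complete (suc m) (suc (suc x) ∷ xs) (_ ∷ pos)    sum≡ =
  ∈-++⁺ʳ _ (∈-map⁺ incrementHead (compositions⁺-complete m (suc x ∷ xs) (s≤s z≤n ∷ pos) (suc-injective sum≡)))

incrementHead-injective : {xs ys : List ℕ} → incrementHead xs ≡ incrementHead ys → xs ≡ ys
incrementHead-injective {[]}    {[]}    _  = refl
incrementHead-injective {_ ∷ _} {_ ∷ _} eq =
  cong₂ _∷_ (suc-injective (List.∷-injectiveˡ eq)) (List.∷-injectiveʳ eq)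

compositions⁺-unique : (m : ℕ) → Unique (compositions⁺ m)
compositions⁺-unique zero    = [] ∷ []
compositions⁺-unique (suc m) =
  Unique.++⁺ (Unique.map⁺ List.∷-injectiveʳ (compositions⁺-unique m))
             (Unique.map⁺ incrementHead-injective (compositions⁺-unique m)) disjoint
  where
  disjoint : ∀ {l} → ¬ (l ∈ map (1 ∷_) (compositions⁺ m) × l ∈ map incrementHead (compositions⁺ m))
  disjoint (l∈₁ , l∈₂) with ∈-map⁻ (1 ∷_) l∈₁ | ∈-map⁻ incrementHead l∈₂
  ... | _ , _ , refl | [] , l′∈ , () 
  ... | _ , _ , refl | x ∷ xs , l′∈ , eq with 1≤x ∷ _ ← proj₁ (compositions⁺-sound m l′∈)
    with () ← subst (1 ≤_) (sym (suc-injective (List.∷-injectiveˡ eq))) 1≤x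

∈compositions : (n : ℕ) {l : List ℕ} → l ∈ compositions n ⇔ (All (1 ≤_) l × sum l ≡ n)
∈compositions zero    {l} = mk⇔ (λ { (here refl) → [] , refl })
                                (λ (pos , sum≡) → here (positive-sum-zero l pos sum≡))
∈compositions (suc m) {l} = mk⇔ (compositions⁺-sound m) (λ (pos , sum≡) → compositions⁺-complete m l pos sum≡)

compositions-unique : (n : ℕ) → Unique (compositions n)
compositions-unique zero    = [] ∷ []
compositions-unique (suc m) = compositions⁺-unique m

occ≤2? : (l : List ℕ) → Dec (∀ h → occ h l ≤ 2)
occ≤2? l = map′ everywhere (λ occ≤2 → All.tabulate (λ {h} _ → occ≤2 h)) (All.all? (λ h → occ h l ≤? 2) l)
  where
  everywhere : All (λ h → occ h l ≤ 2) l → ∀ h → occ h l ≤ 2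
  everywhere on-parts h with h ∈ℕ? l
  ... | yes h∈l = All.lookup on-parts h∈l
  ... | no  h∉l = subst (_≤ 2) (sym (occ≡0 l h∉l)) z≤n

InN? : (i : ℕ) (l : List ℕ) → Dec (InN i l)
InN? i l = map′
  (λ (sorted , pos , nonEmpty , neighbours , occ≤2 , large) → record
    { nonIncreasing = sorted ; positive = pos ; nonEmpty = nonEmpty
    ; cond1 = neighbours ; cond2 = occ≤2 ; cond3 = large })
  (λ l∈N → InN.nonIncreasing l∈N , InN.positive l∈N , InN.nonEmpty l∈N
         , InN.cond1 l∈N , InN.cond2 l∈N , InN.cond3 l∈N)
  (linked? (λ a b → b ≤? a) l ×-dec All.all? (1 ≤?_) l ×-dec 0 <? sum l
   ×-dec Fin.all? (λ j → Fin.any? (λ k → ¬? (k Fin.≟ j) ×-dec ∣ lookup l k - lookup l j ∣ ≤? 1))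
   ×-dec occ≤2? l ×-dec All.all? (3 ∸ i ≤?_) l)

¬spans-[] : {l : List ℕ} → 0 < sum l → ¬ T (spans l [])
¬spans-[] {_ ∷ _} _ ()

if-∧ : (a b : Bool) (v : ℤ) → (if a then (if b then v else 0ℤ) else 0ℤ) ≡ (if a ∧ b then v else 0ℤ)
if-∧ true  b v = refl
if-∧ false b v = refl

indicator-sym : (n : ℕ) → (if 0 ≡ᵇ n then sgn 0 else 0ℤ) ≡ (if n ≡ᵇ 0 then 1ℤ else 0ℤ)
indicator-sym zero    = refl
indicator-sym (suc n) = refl

1≤3∸i : {i : ℕ} → i ≤ 2 → 1 ≤ 3 ∸ i
1≤3∸i i≤2 = m<n⇒0<n∸m (s≤s i≤2)

vertexIndices-[] : (s K : ℕ) → vertexIndices [] s K ≡ []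
vertexIndices-[] s zero    = refl
vertexIndices-[] s (suc K) = vertexIndices-[] s K

module Enumeration (i n : ℕ) (1≤s : 1 ≤ 3 ∸ i) where

  s : ℕ
  s = 3 ∸ i

  edgeSets : List (List GEdge)
  edgeSets = subsets (levelEdges s n)

  weightOf : List GEdge → ℕ
  weightOf E = sum (vertexIndices E s (suc n))

  contribution : List ℕ → List GEdge → ℤ
  contribution l E = if spans l E then sgn (length E) else 0ℤ

  isPartition? : (l : List ℕ) → Dec (InN i l × sum l ≡ n)
  isPartition? l = InN? i l ×-dec sum l ≟ n

  partitions : List (List ℕ)
  partitions = filter isPartition? (compositions n)

  partitions-unique : Unique partitions
  partitions-unique = Unique.filter⁺ isPartition? (compositions-unique n)

  ∈partitions : (l : List ℕ) → l ∈ partitions ⇔ (InN i l × sum l ≡ n)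
  ∈partitions l = mk⇔ (proj₂ ∘ ∈-filter⁻ isPartition? {xs = compositions n})
    (λ (l∈N , sum≡n) → ∈-filter⁺ isPartition?
                         (Equivalence.from (∈compositions n) (InN.positive l∈N , sum≡n)) (l∈N , sum≡n))

  δ-expansion : {l : List ℕ} → l ∈ partitions → δ l ≡ sumℤ (map (contribution l) edgeSets)
  δ-expansion {l} l∈ with l∈N , refl ← Equivalence.to (∈partitions l) l∈ =
    trans (sumℤ-subsets-⊆ _ (levelEdges-unique s n) (edgesG⊆levelEdges 1≤s l∈N))
          (sumℤ-cong edgeSets (λ {E} _ → if-∧ (E ⊆ᵇ edgesG l) (spanning l E) (sgn (length E))))

  contribution-spans : (l : List ℕ) (E : List GEdge) → T (spans l E) → contribution l E ≡ sgn (length E)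
  contribution-spans l E spans-lE with spans l E
  ... | true = refl

  contribution-zero : (l : List ℕ) (E : List GEdge) → ¬ T (spans l E) → contribution l E ≡ 0ℤ
  contribution-zero l E ¬spans-lE with spans l E
  ... | true  with () ← ¬spans-lE tt
  ... | false = refl

  hasWeight : List GEdge → Bool
  hasWeight E = weightOf E ≡ᵇ n

  term : List GEdge → ℤ
  term E = if hasWeight E then sgn (length E) else 0ℤ

  -- A nonempty edge set spans G_λ for exactly one partition λ, namely μ(E).
  partition-sum : {E : List GEdge} → E ∈ edgeSets → E ≢ [] →
    sumℤ (map (λ l → contribution l E) partitions) ≡ term E
  partition-sum {E} E∈ E≢[] with hasWeight E in weight≡ᵇ
  ... | true = trans
    (sumℤ-single (λ l → contribution l E) partitions-unique vertexIndices∈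
      (λ {l} l∈ l≢ → contribution-zero l E (l≢ ∘ spans⇒≡ l l∈)))
    (contribution-spans (vertexIndices E s (suc n)) E (vertexIndices-spans E s n E⊆))
    where
    E⊆ = subsets⁻ (levelEdges s n) E∈
    spans⇒≡ : (l : List ℕ) → l ∈ partitions → T (spans l E) → l ≡ vertexIndices E s (suc n)
    spans⇒≡ l l∈ = spans⇒≡vertexIndices E s n E⊆ (proj₁ (Equivalence.to (∈partitions l) l∈))
    vertexIndices∈ : vertexIndices E s (suc n) ∈ partitions
    vertexIndices∈ = Equivalence.from (∈partitions _)
      (vertexIndices∈N i s n 1≤s ≤-refl E E⊆ E≢[] , ≡ᵇ⇒≡ _ n (subst T (sym weight≡ᵇ) tt))
  ... | false = sumℤ-zero _ partitions (λ {l} l∈ → contribution-zero l E (weight-mismatch l l∈))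
    where
    weight-mismatch : (l : List ℕ) → l ∈ partitions → ¬ T (spans l E)
    weight-mismatch l l∈ spans-lE with l∈N , sum≡n ← Equivalence.to (∈partitions l) l∈ =
      subst T weight≡ᵇ (≡⇒≡ᵇ _ n
        (trans (cong sum (sym (spans⇒≡vertexIndices E s n (subsets⁻ _ E∈) l∈N spans-lE))) sum≡n))

  contribution-[] : {l : List ℕ} → l ∈ partitions → contribution l [] ≡ 0ℤ
  contribution-[] {l} l∈ =
    contribution-zero l [] (¬spans-[] {l} (InN.nonEmpty (proj₁ (Equivalence.to (∈partitions l) l∈))))

  encode : List GEdge → SubG
  encode E = trim (profile E s n)

  weight-encode : {E : List GEdge} → E ⊆ levelEdges s n → weight i (encode E) ≡ weightOf E
  weight-encode {E} E⊆ = trans (wt-trim s false (profile E s n)) (wt-profile-from s n 1≤s E E⊆)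

  nEdges-encode : {E : List GEdge} → E ⊆ levelEdges s n → nEdges (encode E) ≡ length E
  nEdges-encode {E} E⊆ = trans (nEdges-trim (profile E s n)) (nEdges-profile s n E⊆)

  subgraphs : List SubG
  subgraphs = map encode (filterᵇ hasWeight edgeSets)

  ∈filtered⇒⊆ : {E : List GEdge} → E ∈ filterᵇ hasWeight edgeSets → E ⊆ levelEdges s n
  ∈filtered⇒⊆ = subsets⁻ _ ∘ proj₁ ∘ ∈-filter⁻ (T? ∘ hasWeight) {xs = edgeSets}

  subgraphs-unique : Unique subgraphs
  subgraphs-unique = unique-map⁺ (Unique.filter⁺ (T? ∘ hasWeight) (subsets-unique (levelEdges-unique s n)))
    (λ E₁∈ E₂∈ encode≡ → profile-injective s n (∈filtered⇒⊆ E₁∈) (∈filtered⇒⊆ E₂∈)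
                           (trim-injective (trans (length-profile _ s n) (sym (length-profile _ s n))) encode≡))

  ∈subgraphs : (H : SubG) → H ∈ subgraphs ⇔ (Canonical H × weight i H ≡ n)
  ∈subgraphs H = mk⇔ to from
    where
    to : H ∈ subgraphs → Canonical H × weight i H ≡ n
    to H∈ with E , E∈ , refl ← ∈-map⁻ encode H∈ =
      trim-canonical (profile E s n) ,
      trans (weight-encode (∈filtered⇒⊆ E∈)) (≡ᵇ⇒≡ _ n (proj₂ (∈-filter⁻ (T? ∘ hasWeight) {xs = edgeSets} E∈)))
    from : Canonical H × weight i H ≡ n → H ∈ subgraphs
    from (cH , weight≡n) with E , E⊆ , encode≡H ← profile-surjective s n 1≤s H cH weight≡n =
      subst (_∈ subgraphs) encode≡H (∈-map⁺ encode (∈-filter⁺ (T? ∘ hasWeight) (subsets⁺ E⊆)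
        (≡⇒≡ᵇ _ n (trans (sym (weight-encode E⊆)) (trans (cong (weight i) encode≡H) weight≡n)))))

  term-[] : term [] ≡ (if n ≡ᵇ 0 then 1ℤ else 0ℤ)
  term-[] rewrite vertexIndices-[] s (suc n) = indicator-sym n

  identity : (if n ≡ᵇ 0 then 1ℤ else 0ℤ) + sumℤ (map δ partitions) ≡ sumℤ (map (λ H → sgn (nEdges H)) subgraphs)
  identity with T , edgeSets≡ ← subsets-head (levelEdges s n) = begin
    indicator + sumℤ (map δ partitions)
      ≡⟨ cong (indicator +_) (sumℤ-cong partitions δ-expansion) ⟩
    indicator + sumℤ (map (λ l → sumℤ (map (contribution l) edgeSets)) partitions)
      ≡⟨ cong (indicator +_) (sumℤ-swap contribution partitions edgeSets) ⟩
    indicator + sumℤ (map byEdgeSet edgeSets)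
      ≡⟨ cong (λ Es → indicator + sumℤ (map byEdgeSet Es)) edgeSets≡ ⟩
    indicator + (byEdgeSet [] + sumℤ (map byEdgeSet T))
      ≡⟨ cong₂ (λ a b → indicator + (a + b)) (sumℤ-zero _ partitions contribution-[]) (sumℤ-cong T nonempty) ⟩
    indicator + (0ℤ + sumℤ (map term T))
      ≡⟨ cong₂ _+_ (sym term-[]) (ℤ.+-identityˡ _) ⟩
    term [] + sumℤ (map term T)
      ≡⟨ cong (sumℤ ∘ map term) edgeSets≡ ⟨
    sumℤ (map term edgeSets)
      ≡⟨ sumℤ-filterᵇ (sgn ∘ length) hasWeight edgeSets ⟨
    sumℤ (map (sgn ∘ length) (filterᵇ hasWeight edgeSets))
      ≡⟨ sumℤ-cong _ (λ E∈ → cong sgn (sym (nEdges-encode (∈filtered⇒⊆ E∈)))) ⟩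
    sumℤ (map (sgn ∘ nEdges ∘ encode) (filterᵇ hasWeight edgeSets))
      ≡⟨ cong sumℤ (List.map-∘ (filterᵇ hasWeight edgeSets)) ⟩
    sumℤ (map (sgn ∘ nEdges) subgraphs) ∎
    where
    open ≡-Reasoning
    indicator = if n ≡ᵇ 0 then 1ℤ else 0ℤ
    byEdgeSet : List GEdge → ℤ
    byEdgeSet E = sumℤ (map (λ l → contribution l E) partitions)
    []∉T : All ([] ≢_) T
    []∉T with []∉T ∷ _ ← subst Unique edgeSets≡ (subsets-unique (levelEdges-unique s n)) = []∉T
    nonempty : ∀ {E} → E ∈ T → byEdgeSet E ≡ term E
    nonempty {E} E∈T = partition-sum (subst (E ∈_) (sym edgeSets≡) (there E∈T)) (All.lookup []∉T E∈T ∘ sym)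

lemma1 : (i : ℕ) → 1 ≤ i → i ≤ 2 → (n : ℕ) →
    Σ (List (List ℕ)) (λ P →
    Σ (List SubG) (λ L →
      Unique P × ((λs : List ℕ) → (λs ∈ P) ⇔ (InN i λs × sum λs ≡ n)) ×
      Unique L × ((H : SubG) → (H ∈ L) ⇔ (Canonical H × weight i H ≡ n)) ×
      ((if n ≡ᵇ 0 then 1ℤ else 0ℤ) + sumℤ (map δ P)
        ≡ sumℤ (map (λ H → sgn (nEdges H)) L))))
lemma1 i _ i≤2 n =
  partitions , subgraphs , partitions-unique , ∈partitions , subgraphs-unique , ∈subgraphs , identity
  where open Enumeration i n (1≤3∸i i≤2)
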